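{- The rank-one elements (atoms) of $\mathcal{D}_n(G,S)$ are exactly: (1) for $1\leq i<j\leq n$ and $g\in G$, the element $\alpha_{ij}(g)$ whose only non-singleton block is $\{i,j\}$ with $G$-coloring class $[1:g]$ (i.e. $i\mapsto 1$, $j\mapsto g$), all other elements forming singleton blocks and the zero block being empty; and (2) for $1\leq i\leq n$ and $s\in S$, the element $\alpha_i^s$ whose zero block is $\{i\}$ colored by $s$ and whose other blocks are the singletons $\{j\}$, $j\neq i$. Moreover, if $(\tilde\beta,z)\in\mathcal{D}_n(G,S)$ has rank $n-\ell$, then it is covered by exactly $\ell|S|+\binom{\ell}{2}|G|$ elements of rank $n-\ell+1$.
   Context: Let $G$ be a finite group acting on a finite set $S$, $n\geq1$, $[n]=\{1,\dots,n\}$. A projectivized $G$-coloring of a finite set $B$ is an equivalence class $\tilde B$ of functions $b:B\to G$, where $b\sim bg$ (pointwise right multiplication) for $g\in G$. A partial $G$-partition $\tilde\beta$ of $[n]$ is a partition $\beta$ of a subset of $[n]$ into nonempty blocks, each with a projectivized $G$-coloring; its zero block is $Z=[n]\setminus\bigcup_{B\in\beta}B$. $\mathcal{D}_n(G,S)$ is the set of pairs $(\tilde\beta,z)$ with $z:Z\to S$, partially ordered by the order generated by: (merge) $(\tilde\beta\cup\{\tilde A,\tilde B\},z)\prec(\tilde\beta\cup\{\tilde C\},z)$ where $C=A\cup B$ and $c=a\cup bg$ for representatives $a,b$ and some $g\in G$; (color) $(\tilde\beta\cup\{\tilde B\},z)\prec(\tilde\beta,z')$ where $z'$ extends $z$ to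 $Z\cup B$ with $z'|_B=f\circ b$ for some $G$-equivariant $f:G\to S$ ($G$ acting on itself by left multiplication). Rank: $\operatorname{rk}(\tilde\beta,z)=n-\ell(\beta)$, $\ell(\beta)$ the number of blocks. -}

module Defs where

open import Data.Nat using (ℕ; zero; suc; _+_; _*_; _∸_; _<_; _≤_)
open import Data.Fin using (Fin; toℕ) renaming (zero to fzero; suc to fsuc)
open import Data.Fin.Properties using (_≟_)
open import Data.Bool using (Bool; true; false; if_then_else_; _∨_)
open import Data.Sum using (_⊎_; inj₁; inj₂)
open import Data.Product using (Σ; ∃; _×_; _,_)
open import Data.Empty using (⊥)
open import Relation.Nullary using (¬_; yes; no)
open import Relation.Nullary.Decidable using (⌊_⌋)
open import Relation.Binary.PropositionalEquality using (_≡_)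
open import Relation.Binary.Construct.Closure.ReflexiveTransitive using (Star)
open import Algebra.Structures using (IsGroup)

record FinGroup : Set where
  infixl 7 _∙_
  field
    order   : ℕ
    _∙_     : Fin order → Fin order → Fin order
    ε       : Fin order
    _⁻¹     : Fin order → Fin order
    isGroup : IsGroup _≡_ _∙_ ε _⁻¹

record FinAction (G : FinGroup) : Set where
  open FinGroup G
  infixr 6 _•_
  field
    size  : ℕ
    _•_   : Fin order → Fin size → Fin size
    act-ε : ∀ s → ε • s ≡ s
    act-∙ : ∀ g h s → (g ∙ h) • s ≡ g • (h • s)

countFin : ∀ {m} → (Fin m → Bool) → ℕ
countFin {zero}  p = 0
countFin {suc m} p = (if p fzero then 1 else 0) + countFin (λ i → p (fsuc i))

anyFin : ∀ {m} → (Fin m → Bool) → Bool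
anyFin {zero}  p = false
anyFin {suc m} p = p fzero ∨ anyFin (λ i → p (fsuc i))

module D (𝔾 : FinGroup) (𝕊 : FinAction 𝔾) (n : ℕ) where
  open FinGroup 𝔾
  open FinAction 𝕊

  G : Set
  G = Fin order

  S : Set
  S = Fin size

  -- A representative of an element (β̃ , z) of 𝒟ₙ(G,S):
  --   x i = inj₁ s        : i lies in the zero block Z and z(i) = s
  --   x i = inj₂ (k , g)  : i lies in the block labelled k of β, and b(i) = g
  -- The blocks of β are the (nonempty) fibres of the label; the labels
  -- themselves carry no information (see _≈_ below).
  Raw : Set
  Raw = Fin n → S ⊎ (Fin n × G)

  Label : Raw → Fin n → Fin n → Set
  Label x i k = Σ G λ g → x i ≡ inj₂ (k , g)

  Col : Raw → Fin n → G → Set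
  Col x i g = Σ (Fin n) λ k → x i ≡ inj₂ (k , g)

  InBlock : Raw → Fin n → Set
  InBlock x i = Σ (Fin n) λ k → Label x i k

  SameBlock : Raw → Fin n → Fin n → Set
  SameBlock x i j = Σ (Fin n) λ k → Label x i k × Label x j k

  _⇔_ : Set → Set → Set
  A ⇔ B = (A → B) × (B → A)

  -- Two representatives give the same element: same zero block with the
  -- same z, same partition β, and on each block the colourings agree up
  -- to right multiplication by an element of G.
  _≈_ : Raw → Raw → Set
  x ≈ y =
    (∀ i s → (x i ≡ inj₁ s) ⇔ (y i ≡ inj₁ s)) ×
    (∀ i j → SameBlock x i j ⇔ SameBlock y i j) ×
    (∀ i → InBlock x i → Σ G λ c → ∀ j g h →
        SameBlock x i j → Col x j g → Col y j h → h ≡ g ∙ c)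

  isLabel : S ⊎ (Fin n × G) → Fin n → Bool
  isLabel (inj₁ s)       k = false
  isLabel (inj₂ (k' , g)) k = ⌊ k' ≟ k ⌋

  -- ℓ(β): number of blocks = number of labels actually used
  numBlocks : Raw → ℕ
  numBlocks x = countFin (λ k → anyFin (λ i → isLabel (x i) k))

  rk : Raw → ℕ
  rk x = n ∸ numBlocks x

  LabelUsed : Raw → Fin n → Set
  LabelUsed x k = Σ (Fin n) λ i → Label x i k

  -- merge the block labelled kb into the block labelled ka, multiplying
  -- the colouring of the former on the right by g : c = a ∪ b g
  mergeRaw : Raw → Fin n → Fin n → G → Raw
  mergeRaw x ka kb g i with x i
  ... | inj₁ s = inj₁ s
  ... | inj₂ (k , h) with k ≟ kb
  ...   | yes _ = inj₂ (ka , h ∙ g)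
  ...   | no  _ = inj₂ (k , h)

  Equivariant : (G → S) → Set
  Equivariant f = ∀ g h → f (g ∙ h) ≡ g • f h

  colourRaw : Raw → Fin n → (G → S) → Raw
  colourRaw x kb f i with x i
  ... | inj₁ s = inj₁ s
  ... | inj₂ (k , h) with k ≟ kb
  ...   | yes _ = inj₁ (f h)
  ...   | no  _ = inj₂ (k , h)

  data Step (x y : Raw) : Set where
    merge  : (ka kb : Fin n) → ¬ (ka ≡ kb) → LabelUsed x ka → LabelUsed x kb →
             (g : G) → y ≈ mergeRaw x ka kb g → Step x y
    colour : (kb : Fin n) → LabelUsed x kb → (f : G → S) → Equivariant f →
             y ≈ colourRaw x kb f → Step x y

  _≤ᴰ_ : Raw → Raw → Set
  _≤ᴰ_ = Star (λ x y → (x ≈ y) ⊎ Step x y)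

  _<ᴰ_ : Raw → Raw → Set
  x <ᴰ y = (x ≤ᴰ y) × ¬ (y ≤ᴰ x)

  _⋖_ : Raw → Raw → Set
  x ⋖ y = (x <ᴰ y) × ¬ (Σ Raw λ w → (x <ᴰ w) × (w <ᴰ y))

  -- exactly N elements of 𝒟ₙ(G,S) (i.e. ≈-classes) satisfy P
  HasExactly : (Raw → Set) → ℕ → Set
  HasExactly P N = Σ (Fin N → Raw) λ f →
    (∀ a → P (f a)) ×
    (∀ a b → f a ≈ f b → a ≡ b) ×
    (∀ y → P y → Σ (Fin N) λ a → y ≈ f a)

  αpair : Fin n → Fin n → G → Raw
  αpair i j g m with m ≟ i | m ≟ j
  ... | yes _ | _     = inj₂ (i , ε)
  ... | no _  | yes _ = inj₂ (i , g)
  ... | no _  | no _  = inj₂ (m , ε)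

  αzero : Fin n → S → Raw
  αzero i s m with m ≟ i
  ... | yes _ = inj₁ s
  ... | no _  = inj₂ (m , ε)

-- The whole argument rests on one invariant: ≈ preserves the number of
-- blocks, and each generating step (merge two blocks, or send a block to
-- the zero block) deletes exactly one label, hence one block.  So going up
-- in ≤ᴰ lowers numBlocks, strict comparisons lower it strictly, every step
-- is a cover, and a chain losing one block is a single step up to ≈.
--
-- Listing the ℓ blocks of x as lab 0 … lab (ℓ-1), the steps
-- "colour block a by h ↦ h • s" and "merge block b into block a (a < b)
-- with g" are pairwise inequivalent covers, and any step out of any
-- representative of x is equivalent to one of them (the multiplier of
-- x ≈ z is absorbed into s resp. g).  The index set is in bijection with
-- Fin (ℓ|S| + (ℓ choose 2)|G|).
--
-- Every block has a chosen witness point, so the witnesses count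
-- the blocks; rank one means exactly one point is not a witness, which
-- forces the shape α_i^s or α_ij(g).  Conversely the atoms delete one
-- label from the discrete element, so they have rank one.
module Submission where

open import Defs
open import Data.Nat using (ℕ; _+_; _*_; _∸_; _≤_; _<_)
open import Data.Nat.Combinatorics using (_C_)
open import Data.Fin using (Fin; toℕ)
open import Data.Sum using (_⊎_)
open import Data.Product using (Σ; _×_)
open import Relation.Binary.PropositionalEquality using (_≡_)
open import Data.Product using (_,_)

module Counting where

  open import Data.Nat using (zero; suc)
  open import Data.Nat.Properties using (+-suc)
  open import Data.Fin using () renaming (zero to fzero; suc to fsuc)
  open import Data.Fin.Properties using (injective⇒≤; _≟_; suc-injective)
  open import Data.Bool using (Bool; true; false; if_then_else_; _∧_; not)
  open import Data.Bool.Properties using (∧-identityʳ)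
  open import Data.Product using (proj₁; proj₂)
  open import Relation.Nullary using (yes; no)
  open import Relation.Nullary.Decidable using (⌊_⌋)
  open import Relation.Binary.PropositionalEquality

  countFin-cong : ∀ {m} (p q : Fin m → Bool) → (∀ i → p i ≡ q i) → countFin p ≡ countFin q
  countFin-cong {zero}  p q e = refl
  countFin-cong {suc m} p q e rewrite e fzero =
    cong ((if q fzero then 1 else 0) +_) (countFin-cong (λ i → p (fsuc i)) (λ i → q (fsuc i)) (λ i → e (fsuc i)))

  select : ∀ {m} (p : Fin m → Bool) → Fin (countFin p) → Fin m
  select {suc m} p a with p fzero
  select {suc m} p fzero    | true  = fzero
  select {suc m} p (fsuc a) | true  = fsuc (select (λ i → p (fsuc i)) a)
  select {suc m} p a        | false = fsuc (select (λ i → p (fsuc i)) a)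

  select-sound : ∀ {m} (p : Fin m → Bool) a → p (select p a) ≡ true
  select-sound {suc m} p a with p fzero in eq
  select-sound {suc m} p fzero    | true  = eq
  select-sound {suc m} p (fsuc a) | true  = select-sound (λ i → p (fsuc i)) a
  select-sound {suc m} p a        | false = select-sound (λ i → p (fsuc i)) a

  select-injective : ∀ {m} (p : Fin m → Bool) a b → select p a ≡ select p b → a ≡ b
  select-injective {suc m} p a b e with p fzero
  select-injective {suc m} p fzero    fzero    e  | true = refl
  select-injective {suc m} p (fsuc a) (fsuc b) e  | true =
    cong fsuc (select-injective (λ i → p (fsuc i)) a b (suc-injective e))
  select-injective {suc m} p a b e | false = select-injective (λ i → p (fsuc i)) a b (suc-injective e)

  select-complete : ∀ {m} (p : Fin m → Bool) i → p i ≡ true → Σ (Fin (countFin p)) λ a → select p a ≡ i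
  select-complete {suc m} p i e with p fzero in eq
  select-complete {suc m} p fzero    e | true  = fzero , refl
  select-complete {suc m} p (fsuc i) e | true
    with a , r ← select-complete (λ i → p (fsuc i)) i e = fsuc a , cong fsuc r
  select-complete {suc m} p fzero    e | false with () ← trans (sym eq) e
  select-complete {suc m} p (fsuc i) e | false
    with a , r ← select-complete (λ i → p (fsuc i)) i e = a , cong fsuc r

  countFin-injection : ∀ {m m'} (p : Fin m → Bool) (q : Fin m' → Bool) (f : Fin m → Fin m') →
    (∀ i → p i ≡ true → q (f i) ≡ true) →
    (∀ i j → p i ≡ true → p j ≡ true → f i ≡ f j → i ≡ j) → countFin p ≤ countFin q
  countFin-injection p q f pres inj = injective⇒≤ {f = h} h-injective
    where
    image : ∀ a → Σ (Fin (countFin q)) λ b → select q b ≡ f (select p a)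
    image a = select-complete q (f (select p a)) (pres _ (select-sound p a))
    h : Fin (countFin p) → Fin (countFin q)
    h a = proj₁ (image a)
    h-injective : ∀ {a b} → h a ≡ h b → a ≡ b
    h-injective {a} {b} e = select-injective p a b
      (inj _ _ (select-sound p a) (select-sound p b)
        (trans (sym (proj₂ (image a))) (trans (cong (select q) e) (proj₂ (image b)))))

  countFin-all : ∀ m → countFin {m} (λ _ → true) ≡ m
  countFin-all zero    = refl
  countFin-all (suc m) = cong suc (countFin-all m)

  countFin-compl : ∀ {m} (p : Fin m → Bool) → countFin p + countFin (λ i → not (p i)) ≡ m
  countFin-compl {zero}  p = refl
  countFin-compl {suc m} p with p fzero
  ... | true  = cong suc (countFin-compl (λ i → p (fsuc i)))
  ... | false = trans (+-suc _ _) (cong suc (countFin-compl (λ i → p (fsuc i))))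

  countFin-one : ∀ {m} (p : Fin m → Bool) → countFin p ≡ 1 →
    Σ (Fin m) λ i → (p i ≡ true) × (∀ j → p j ≡ true → j ≡ i)
  countFin-one p e = select p a₀ , select-sound p a₀ , unique
    where
    a₀ : Fin (countFin p)
    a₀ = subst Fin (sym e) fzero
    fin1 : ∀ k → k ≡ 1 → (a b : Fin k) → a ≡ b
    fin1 .1 refl fzero fzero = refl
    unique : ∀ j → p j ≡ true → j ≡ select p a₀
    unique j pj with a , r ← select-complete p j pj = trans (sym r) (cong (select p) (fin1 _ e a a₀))

  ⌊suc≟suc⌋ : ∀ {m} (i k : Fin m) → ⌊ fsuc i ≟ fsuc k ⌋ ≡ ⌊ i ≟ k ⌋
  ⌊suc≟suc⌋ i k with i ≟ k
  ... | yes _ = refl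
  ... | no  _ = refl

  countFin-remove : ∀ {m} (p : Fin m → Bool) k → p k ≡ true →
    countFin p ≡ suc (countFin (λ i → p i ∧ not ⌊ i ≟ k ⌋))
  countFin-remove {suc m} p fzero e rewrite e =
    cong suc (countFin-cong _ _ (λ i → sym (∧-identityʳ (p (fsuc i)))))
  countFin-remove {suc m} p (fsuc k) e with p fzero
  ... | true  = cong suc (trans (countFin-remove (λ i → p (fsuc i)) k e) (cong suc shift))
    where shift = countFin-cong _ _ (λ i → cong (λ b → p (fsuc i) ∧ not b) (sym (⌊suc≟suc⌋ i k)))
  ... | false = trans (countFin-remove (λ i → p (fsuc i)) k e) (cong suc shift)
    where shift = countFin-cong _ _ (λ i → cong (λ b → p (fsuc i) ∧ not b) (sym (⌊suc≟suc⌋ i k)))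

  anyFin-sound : ∀ {m} (p : Fin m → Bool) → anyFin p ≡ true → Σ (Fin m) λ i → p i ≡ true
  anyFin-sound {suc m} p e with p fzero in eq
  ... | true  = fzero , eq
  ... | false with i , r ← anyFin-sound (λ i → p (fsuc i)) e = fsuc i , r

  anyFin-complete : ∀ {m} (p : Fin m → Bool) i → p i ≡ true → anyFin p ≡ true
  anyFin-complete {suc m} p fzero e rewrite e = refl
  anyFin-complete {suc m} p (fsuc i) e with p fzero
  ... | true  = refl
  ... | false = anyFin-complete (λ i → p (fsuc i)) i e

module Enumeration where

  open import Data.Nat using (zero; suc; s≤s; z≤n)
  open import Data.Nat.Properties using (<-irrelevant)
  open import Data.Nat.Combinatorics using (nC1≡n; nCk+nC[k+1]≡[n+1]C[k+1])
  open import Data.Fin using () renaming (zero to fzero; suc to fsuc)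
  open import Data.Fin.Properties using (+↔⊎)
  open import Data.Sum using (inj₁; inj₂)
  open import Data.Sum.Function.Propositional using (_⊎-↔_)
  open import Data.Product using (proj₁; proj₂)
  open import Function.Bundles using (_↔_; mk↔ₛ′)
  open import Function.Properties.Inverse using (↔-refl; ↔-sym; ↔-trans)
  open import Relation.Binary.PropositionalEquality

  Fin-↔ : ∀ {m m'} → m ≡ m' → Fin m ↔ Fin m'
  Fin-↔ refl = ↔-refl

  Pairs : ℕ → Set
  Pairs ℓ = Σ (Fin ℓ × Fin ℓ) λ p → toℕ (proj₁ p) < toℕ (proj₂ p)

  pairs-≡ : ∀ {ℓ} (p q : Pairs ℓ) → proj₁ p ≡ proj₁ q → p ≡ q
  pairs-≡ (p , lt) (.p , lt') refl = cong (p ,_) (<-irrelevant lt lt')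

  -- A pair in Fin (1 + ℓ) either contains 0, or is a shifted pair in Fin ℓ.
  pairs-suc↔ : ∀ {ℓ} → Pairs (suc ℓ) ↔ (Fin ℓ ⊎ Pairs ℓ)
  pairs-suc↔ {ℓ} = mk↔ₛ′ split join split-join join-split
    where
    split : Pairs (suc ℓ) → Fin ℓ ⊎ Pairs ℓ
    split ((fzero  , fsuc b) , _)       = inj₁ b
    split ((fsuc a , fsuc b) , s≤s lt) = inj₂ ((a , b) , lt)
    join : Fin ℓ ⊎ Pairs ℓ → Pairs (suc ℓ)
    join (inj₁ b)             = (fzero , fsuc b) , s≤s z≤n
    join (inj₂ ((a , b) , lt)) = (fsuc a , fsuc b) , s≤s lt
    split-join : ∀ y → split (join y) ≡ y
    split-join (inj₁ b) = refl
    split-join (inj₂ _) = refl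
    join-split : ∀ p → join (split p) ≡ p
    join-split p@((fzero  , fsuc b) , _) = pairs-≡ _ p refl
    join-split p@((fsuc a , fsuc b) , s≤s lt) = refl

  -- There are ℓ choose 2 such pairs (Pascal's rule drives the induction).
  pairs↔ : ∀ ℓ → Fin (ℓ C 2) ↔ Pairs ℓ
  pairs↔ zero    = mk↔ₛ′ (λ ()) (λ { ((() , _) , _) }) (λ { ((() , _) , _) }) (λ ())
  pairs↔ (suc ℓ) =
    ↔-trans (Fin-↔ (sym (nCk+nC[k+1]≡[n+1]C[k+1] ℓ 1)))
      (↔-trans +↔⊎ (↔-trans (Fin-↔ (nC1≡n ℓ) ⊎-↔ pairs↔ ℓ) (↔-sym pairs-suc↔)))

module Theory (𝔾 : FinGroup) (𝕊 : FinAction 𝔾) (n : ℕ) where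

  open import Data.Nat using (zero; suc; s≤s)
  open import Data.Nat.Properties
    using (≤-antisym; ≤-trans; ≤-refl; ≤-reflexive; n≤1+n; <⇒≱; m≤n⇒m<n∨m≡n; 1+n≢n; suc-injective;
           <-irrefl; <-asym; <-cmp; ≤-pred; m≤m+n; ∸-cancelˡ-≡; +-cancelˡ-≡; m+[n∸m]≡n; m+n∸n≡m; +-comm; +-cancelʳ-≡)
  open import Data.Fin using () renaming (zero to fzero; suc to fsuc)
  open import Data.Fin.Properties using (_≟_; any?; toℕ-injective; +↔⊎; *↔×)
  open import Data.Bool using (Bool; true; false; not; _∧_)
  import Data.Bool.Properties as Boolₚ
  open import Data.Sum using (inj₁; inj₂; swap) renaming (map to map⊎)
  open import Data.Product using (proj₁; proj₂)
  open import Data.Empty using (⊥; ⊥-elim)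
  open import Function.Bundles using (_↔_; Inverse)
  open import Function.Properties.Inverse using (↔-refl; ↔-trans)
  open import Data.Sum.Function.Propositional using (_⊎-↔_)
  open import Data.Product.Function.NonDependent.Propositional using (_×-↔_)
  open import Relation.Nullary using (¬_; yes; no; Dec)
  open import Relation.Nullary.Decidable using (⌊_⌋; _⊎-dec_)
  open import Relation.Binary.Definitions using (tri<; tri≈; tri>; Tri)
  open import Relation.Binary.Construct.Closure.ReflexiveTransitive using (_◅_) renaming (ε to [])
  open import Relation.Binary.PropositionalEquality
  open import Algebra.Bundles using (Group)
  open import Algebra.Structures using (IsGroup)
  import Algebra.Properties.Group as GroupProperties

  open FinGroup 𝔾
  open FinAction 𝕊
  open D 𝔾 𝕊 n
  open IsGroup isGroup using (assoc; identityʳ; inverseˡ; inverseʳ)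

  private
    group : Group _ _
    group = record { isGroup = isGroup }
  open GroupProperties group using (∙-cancelˡ; //-rightDividesˡ; //-rightDividesʳ)

  Entry : Set
  Entry = S ⊎ (Fin n × G)

  label-injective : ∀ {k k' g g'} → _≡_ {A = Entry} (inj₂ (k , g)) (inj₂ (k' , g')) → k ≡ k'
  label-injective refl = refl

  colour-injective : ∀ {k k' g g'} → _≡_ {A = Entry} (inj₂ (k , g)) (inj₂ (k' , g')) → g ≡ g'
  colour-injective refl = refl

  zero-injective : ∀ {s s'} → _≡_ {A = Entry} (inj₁ s) (inj₁ s') → s ≡ s'
  zero-injective refl = refl

  zero≢block : ∀ {s k g} → ¬ (_≡_ {A = Entry} (inj₁ s) (inj₂ (k , g)))
  zero≢block ()

  data Shape (v : Entry) : Set where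
    zero-entry  : (s : S) → v ≡ inj₁ s → Shape v
    block-entry : (k : Fin n) (g : G) → v ≡ inj₂ (k , g) → Shape v

  shape : (v : Entry) → Shape v
  shape (inj₁ s)       = zero-entry s refl
  shape (inj₂ (k , g)) = block-entry k g refl

  Label-functional : ∀ x i {k k'} → Label x i k → Label x i k' → k ≡ k'
  Label-functional x i (_ , e) (_ , e') = label-injective (trans (sym e) e')

  Col-functional : ∀ x i {g g'} → Col x i g → Col x i g' → g ≡ g'
  Col-functional x i (_ , e) (_ , e') = colour-injective (trans (sym e) e')

  SameBlock-sym : ∀ x {i j} → SameBlock x i j → SameBlock x j i
  SameBlock-sym x (k , a , b) = k , b , a

  SameBlock-trans : ∀ x {i j m} → SameBlock x i j → SameBlock x j m → SameBlock x i m
  SameBlock-trans x {j = j} (k , a , b) (k' , b' , c) with refl ← Label-functional x j b b' = k , a , c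

  SameBlock-refl : ∀ x {i} → InBlock x i → SameBlock x i i
  SameBlock-refl x (k , l) = k , l , l

  SameBlock⇒InBlock : ∀ x {i j} → SameBlock x i j → InBlock x i
  SameBlock⇒InBlock x (k , a , _) = k , a

  InBlock⇒Col : ∀ x {i} → InBlock x i → Σ G λ g → Col x i g
  InBlock⇒Col x (k , g , e) = g , k , e

  Col⇒InBlock : ∀ x {i g} → Col x i g → InBlock x i
  Col⇒InBlock x (k , e) = k , _ , e

  InBlock⇒nonzero : ∀ x {i} s → InBlock x i → ¬ (x i ≡ inj₁ s)
  InBlock⇒nonzero x s (k , g , e) e' = zero≢block (trans (sym e') e)

  sameBlock? : ∀ x i j → Dec (SameBlock x i j)
  sameBlock? x i j with shape (x i) | shape (x j)
  ... | zero-entry s r | _ = no λ sb → InBlock⇒nonzero x s (SameBlock⇒InBlock x sb) r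
  ... | block-entry _ _ _ | zero-entry s r = no λ sb → InBlock⇒nonzero x s (SameBlock⇒InBlock x (SameBlock-sym x sb)) r
  ... | block-entry k g r | block-entry k' g' r' with k ≟ k'
  ...   | yes refl = yes (k , (g , r) , (g' , r'))
  ...   | no k≢k' = no λ (_ , li , lj) → k≢k' (trans (Label-functional x i (g , r) li) (Label-functional x j lj (g' , r')))

  open Counting
  open Enumeration

  usedᵇ : Raw → Fin n → Bool
  usedᵇ x k = anyFin (λ i → isLabel (x i) k)

  isLabel-sound : ∀ v k → isLabel v k ≡ true → Σ G λ g → v ≡ inj₂ (k , g)
  isLabel-sound (inj₂ (k' , g)) k e with k' ≟ k
  isLabel-sound (inj₂ (k' , g)) k e  | yes refl = g , refl
  isLabel-sound (inj₂ (k' , g)) k () | no _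

  isLabel-self : ∀ k g → isLabel (inj₂ (k , g)) k ≡ true
  isLabel-self k g with k ≟ k
  ... | yes _ = refl
  ... | no k≢k = ⊥-elim (k≢k refl)

  usedᵇ-sound : ∀ x k → usedᵇ x k ≡ true → LabelUsed x k
  usedᵇ-sound x k e with i , r ← anyFin-sound _ e = i , isLabel-sound (x i) k r

  usedᵇ-complete : ∀ x k → LabelUsed x k → usedᵇ x k ≡ true
  usedᵇ-complete x k (i , g , e) = anyFin-complete _ i (subst (λ v → isLabel v k ≡ true) (sym e) (isLabel-self k g))

  -- A chosen point carrying the label k (meaningful when k is in use).
  witness : Raw → Fin n → Fin n
  witness x k with any? (λ i → isLabel (x i) k Boolₚ.≟ true)
  ... | yes (i , _) = i
  ... | no _        = k

  witness-label : ∀ x k → LabelUsed x k → Label x (witness x k) k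
  witness-label x k used with any? (λ i → isLabel (x i) k Boolₚ.≟ true)
  ... | yes (i , r) = isLabel-sound (x i) k r
  ... | no none = ⊥-elim (none (proj₁ used , isLabel-at used))
    where isLabel-at : ∀ {k} (u : LabelUsed x k) → isLabel (x (proj₁ u)) k ≡ true
          isLabel-at {k} (i , g , e) = subst (λ v → isLabel v k ≡ true) (sym e) (isLabel-self k g)

  labelAt : Entry → Fin n → Fin n
  labelAt (inj₁ _)       d = d
  labelAt (inj₂ (k , _)) _ = k

  labelAt-sound : ∀ x i d → InBlock x i → Label x i (labelAt (x i) d)
  labelAt-sound x i d (k , g , e) rewrite e = g , refl

  SameBlocks : Raw → Raw → Set
  SameBlocks x y = ∀ i j → SameBlock x i j ⇔ SameBlock y i j

  SameBlocks-sym : ∀ {x y} → SameBlocks x y → SameBlocks y x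
  SameBlocks-sym h i j = proj₂ (h i j) , proj₁ (h i j)

  -- The number of blocks depends only on the partition: sending each label
  -- of x to the y-label of its witness is injective on labels in use.
  numBlocks-≤ : ∀ x y → SameBlocks x y → numBlocks x ≤ numBlocks y
  numBlocks-≤ x y h = countFin-injection (usedᵇ x) (usedᵇ y) relabel preserves injective
    where
    w : Fin n → Fin n
    w = witness x
    relabel : Fin n → Fin n
    relabel k = labelAt (y (w k)) k
    inY : ∀ k → usedᵇ x k ≡ true → InBlock y (w k)
    inY k u = SameBlock⇒InBlock y (proj₁ (h _ _) (SameBlock-refl x (k , witness-label x k (usedᵇ-sound x k u))))
    labelY : ∀ k (u : usedᵇ x k ≡ true) → Label y (w k) (relabel k)
    labelY k u = labelAt-sound y (w k) k (inY k u)
    preserves : ∀ k → usedᵇ x k ≡ true → usedᵇ y (relabel k) ≡ true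
    preserves k u = usedᵇ-complete y (relabel k) (w k , labelY k u)
    injective : ∀ k k' → usedᵇ x k ≡ true → usedᵇ x k' ≡ true → relabel k ≡ relabel k' → k ≡ k'
    injective k k' u u' e
      with _ , a , b ← proj₂ (h _ _) (relabel k , labelY k u , subst (Label y (w k')) (sym e) (labelY k' u')) =
      trans (Label-functional x _ (witness-label x k (usedᵇ-sound x k u)) a)
            (Label-functional x _ b (witness-label x k' (usedᵇ-sound x k' u')))

  numBlocks-cong : ∀ x y → SameBlocks x y → numBlocks x ≡ numBlocks y
  numBlocks-cong x y h = ≤-antisym (numBlocks-≤ x y h) (numBlocks-≤ y x (SameBlocks-sym h))

  numBlocks≤n : ∀ x → numBlocks x ≤ n
  numBlocks≤n x = subst (numBlocks x ≤_) (countFin-compl (usedᵇ x)) (m≤m+n _ _)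

  ⇔-refl : ∀ {A : Set} → A ⇔ A
  ⇔-refl = (λ a → a) , (λ a → a)

  ≈-refl : ∀ x → x ≈ x
  ≈-refl x = (λ _ _ → ⇔-refl) , (λ _ _ → ⇔-refl) ,
    λ _ _ → ε , λ j g h _ cg ch → trans (Col-functional x j ch cg) (sym (identityʳ g))

  ≈-sym : ∀ x y → x ≈ y → y ≈ x
  ≈-sym x y (zeros , blocks , colours) =
    (λ i s → proj₂ (zeros i s) , proj₁ (zeros i s)) , SameBlocks-sym blocks ,
    λ i iy → let ix = SameBlock⇒InBlock x (proj₂ (blocks i i) (SameBlock-refl y iy))
                 c = proj₁ (colours i ix) in
      c ⁻¹ , λ j g h sb cg ch → begin
        h               ≡⟨ //-rightDividesʳ c h ⟨
        (h ∙ c) ∙ c ⁻¹  ≡⟨ cong (_∙ c ⁻¹) (proj₂ (colours i ix) j h g (proj₂ (blocks i j) sb) ch cg) ⟨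
        g ∙ c ⁻¹        ∎
    where open ≡-Reasoning

  ≈-trans : ∀ x y z → x ≈ y → y ≈ z → x ≈ z
  ≈-trans x y z (zx , bx , cx) (zy , by , cy) =
    (λ i s → (λ e → proj₁ (zy i s) (proj₁ (zx i s) e)) , (λ e → proj₂ (zx i s) (proj₂ (zy i s) e))) ,
    (λ i j → (λ e → proj₁ (by i j) (proj₁ (bx i j) e)) , (λ e → proj₂ (bx i j) (proj₂ (by i j) e))) ,
    λ i ix → let iy = SameBlock⇒InBlock y (proj₁ (bx i i) (SameBlock-refl x ix))
                 c = proj₁ (cx i ix)
                 c' = proj₁ (cy i iy) in
      c ∙ c' , λ j g h sb cg ch →
        let sby = proj₁ (bx i j) sb
            (g' , cg') = InBlock⇒Col y (SameBlock⇒InBlock y (SameBlock-sym y sby)) in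
        begin
          h              ≡⟨ proj₂ (cy i iy) j g' h sby cg' ch ⟩
          g' ∙ c'        ≡⟨ cong (_∙ c') (proj₂ (cx i ix) j g g' sb cg cg') ⟩
          (g ∙ c) ∙ c'   ≡⟨ assoc g c c' ⟩
          g ∙ (c ∙ c')   ∎
    where open ≡-Reasoning

  ≈⇒SameBlocks : ∀ {x y} → x ≈ y → SameBlocks x y
  ≈⇒SameBlocks (_ , blocks , _) = blocks

  numBlocks-≈ : ∀ x y → x ≈ y → numBlocks x ≡ numBlocks y
  numBlocks-≈ x y e = numBlocks-cong x y (≈⇒SameBlocks e)

  ≈-by-multiplier : ∀ x y → (∀ i s → (x i ≡ inj₁ s) ⇔ (y i ≡ inj₁ s)) → SameBlocks x y →
    (c : Fin n → G) → (∀ i g h → Col x i g → Col y i h → h ≡ g ∙ c i) →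
    (∀ i j → SameBlock x i j → c i ≡ c j) → x ≈ y
  ≈-by-multiplier x y zeros blocks c colours const = zeros , blocks , λ i _ → c i , λ j g h sb cg ch →
    trans (colours j g h cg ch) (cong (g ∙_) (sym (const i j sb)))

  multiplier : ∀ x z → x ≈ z → Fin n → G
  multiplier x z (_ , _ , colours) i with shape (x i)
  ... | zero-entry _ _      = ε
  ... | block-entry k g r = proj₁ (colours i (k , g , r))

  multiplier-block : ∀ x z (e : x ≈ z) i j {g h} → SameBlock x i j → Col x j g → Col z j h →
    h ≡ g ∙ multiplier x z e i
  multiplier-block x z e@(_ , _ , colours) i j {g} {h} sb cg ch with shape (x i)
  ... | zero-entry s r = ⊥-elim (InBlock⇒nonzero x s (SameBlock⇒InBlock x sb) r)
  ... | block-entry k g' r = proj₂ (colours i (k , g' , r)) j g h sb cg ch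

  multiplier-at : ∀ x z (e : x ≈ z) i {g h} → Col x i g → Col z i h → h ≡ g ∙ multiplier x z e i
  multiplier-at x z e i cg ch = multiplier-block x z e i i (SameBlock-refl x (Col⇒InBlock x cg)) cg ch

  multiplier-const : ∀ x z (e : x ≈ z) i j → SameBlock x i j → multiplier x z e i ≡ multiplier x z e j
  multiplier-const x z e i j sb = ∙-cancelˡ g _ _
    (trans (sym (multiplier-block x z e i j sb cg ch)) (multiplier-at x z e j cg ch))
    where
    cj = InBlock⇒Col x (SameBlock⇒InBlock x (SameBlock-sym x sb))
    g = proj₁ cj
    cg = proj₂ cj
    ch = proj₂ (InBlock⇒Col z (SameBlock⇒InBlock z (SameBlock-sym z (proj₁ (≈⇒SameBlocks e i j) sb))))

  colour-zero : ∀ x kb f j {s} → x j ≡ inj₁ s → colourRaw x kb f j ≡ inj₁ s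
  colour-zero x kb f j e with x j
  colour-zero x kb f j refl | _ = refl

  colour-moved : ∀ x kb f j {h} → x j ≡ inj₂ (kb , h) → colourRaw x kb f j ≡ inj₁ (f h)
  colour-moved x kb f j e with x j
  colour-moved x kb f j refl | _ with kb ≟ kb
  ... | yes _ = refl
  ... | no kb≢kb = ⊥-elim (kb≢kb refl)

  colour-other : ∀ x kb f j {k h} → x j ≡ inj₂ (k , h) → ¬ (k ≡ kb) → colourRaw x kb f j ≡ inj₂ (k , h)
  colour-other x kb f j e k≢kb with x j
  colour-other x kb f j {k} refl k≢kb | _ with k ≟ kb
  ... | yes k≡kb = ⊥-elim (k≢kb k≡kb)
  ... | no _ = refl

  merge-zero : ∀ x ka kb g j {s} → x j ≡ inj₁ s → mergeRaw x ka kb g j ≡ inj₁ s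
  merge-zero x ka kb g j e with x j
  merge-zero x ka kb g j refl | _ = refl

  merge-moved : ∀ x ka kb g j {h} → x j ≡ inj₂ (kb , h) → mergeRaw x ka kb g j ≡ inj₂ (ka , h ∙ g)
  merge-moved x ka kb g j e with x j
  merge-moved x ka kb g j refl | _ with kb ≟ kb
  ... | yes _ = refl
  ... | no kb≢kb = ⊥-elim (kb≢kb refl)

  merge-other : ∀ x ka kb g j {k h} → x j ≡ inj₂ (k , h) → ¬ (k ≡ kb) → mergeRaw x ka kb g j ≡ inj₂ (k , h)
  merge-other x ka kb g j e k≢kb with x j
  merge-other x ka kb g j {k} refl k≢kb | _ with k ≟ kb
  ... | yes k≡kb = ⊥-elim (k≢kb k≡kb)
  ... | no _ = refl

  merge-zero⁻¹ : ∀ x ka kb g j {s} → mergeRaw x ka kb g j ≡ inj₁ s → x j ≡ inj₁ s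
  merge-zero⁻¹ x ka kb g j e with shape (x j)
  ... | zero-entry t r = trans r (trans (sym (merge-zero x ka kb g j r)) e)
  ... | block-entry k h r with k ≟ kb
  ...   | yes refl = ⊥-elim (zero≢block (trans (sym e) (merge-moved x ka kb g j r)))
  ...   | no k≢kb  = ⊥-elim (zero≢block (trans (sym e) (merge-other x ka kb g j r k≢kb)))

  merge-labels : ∀ x ka kb g → LabelUsed x ka → ¬ (ka ≡ kb) → ∀ k →
    LabelUsed (mergeRaw x ka kb g) k ⇔ (LabelUsed x k × ¬ (k ≡ kb))
  merge-labels x ka kb g ka-used ka≢kb k = to , from
    where
    to : LabelUsed (mergeRaw x ka kb g) k → LabelUsed x k × ¬ (k ≡ kb)
    to (i , h , e) with shape (x i)
    ... | zero-entry s r = ⊥-elim (zero≢block (trans (sym (merge-zero x ka kb g i r)) e))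
    ... | block-entry k₀ h₀ r with k₀ ≟ kb
    ...   | yes refl = subst (λ k' → LabelUsed x k' × ¬ (k' ≡ kb))
                         (label-injective (trans (sym (merge-moved x ka kb g i r)) e)) (ka-used , ka≢kb)
    ...   | no k₀≢kb = subst (λ k' → LabelUsed x k' × ¬ (k' ≡ kb))
                         (label-injective (trans (sym (merge-other x ka kb g i r k₀≢kb)) e)) ((i , h₀ , r) , k₀≢kb)
    from : LabelUsed x k × ¬ (k ≡ kb) → LabelUsed (mergeRaw x ka kb g) k
    from ((i , h , e) , k≢kb) = i , h , merge-other x ka kb g i e k≢kb

  colour-labels : ∀ x kb f k → LabelUsed (colourRaw x kb f) k ⇔ (LabelUsed x k × ¬ (k ≡ kb))
  colour-labels x kb f k = to , from
    where
    to : LabelUsed (colourRaw x kb f) k → LabelUsed x k × ¬ (k ≡ kb)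
    to (i , h , e) with shape (x i)
    ... | zero-entry s r = ⊥-elim (zero≢block (trans (sym (colour-zero x kb f i r)) e))
    ... | block-entry k₀ h₀ r with k₀ ≟ kb
    ...   | yes refl = ⊥-elim (zero≢block (trans (sym (colour-moved x kb f i r)) e))
    ...   | no k₀≢kb = subst (λ k' → LabelUsed x k' × ¬ (k' ≡ kb))
                         (label-injective (trans (sym (colour-other x kb f i r k₀≢kb)) e)) ((i , h₀ , r) , k₀≢kb)
    from : LabelUsed x k × ¬ (k ≡ kb) → LabelUsed (colourRaw x kb f) k
    from ((i , h , e) , k≢kb) = i , h , colour-other x kb f i e k≢kb

  ∧-not-≟ : ∀ (b : Bool) (k kb : Fin n) → (b ∧ not ⌊ k ≟ kb ⌋ ≡ true) ⇔ ((b ≡ true) × ¬ (k ≡ kb))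
  ∧-not-≟ b k kb with k ≟ kb
  ∧-not-≟ true  k kb | no k≢kb = (λ _ → refl , k≢kb) , (λ _ → refl)
  ∧-not-≟ false k kb | no k≢kb = (λ ()) , (λ ())
  ∧-not-≟ b     k kb | yes k≡kb rewrite Boolₚ.∧-zeroʳ b = (λ ()) , (λ (_ , k≢kb) → ⊥-elim (k≢kb k≡kb))

  bool-ext : ∀ {b c : Bool} → (b ≡ true) ⇔ (c ≡ true) → b ≡ c
  bool-ext {true}  {true}  _ = refl
  bool-ext {false} {false} _ = refl
  bool-ext {true}  {false} (f , _) = sym (f refl)
  bool-ext {false} {true}  (_ , g) = g refl

  numBlocks-delete : ∀ x y kb → LabelUsed x kb → (∀ k → LabelUsed y k ⇔ (LabelUsed x k × ¬ (k ≡ kb))) →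
    numBlocks x ≡ suc (numBlocks y)
  numBlocks-delete x y kb kb-used h =
    trans (countFin-remove (usedᵇ x) kb (usedᵇ-complete x kb kb-used))
      (cong suc (countFin-cong _ _ λ k → bool-ext
        ( (λ e → let (u , k≢kb) = proj₁ (∧-not-≟ _ k kb) e in
                   usedᵇ-complete y k (proj₂ (h k) (usedᵇ-sound x k u , k≢kb)))
        , (λ e → let (u , k≢kb) = proj₁ (h k) (usedᵇ-sound y k e) in
                   proj₂ (∧-not-≟ _ k kb) (usedᵇ-complete x k u , k≢kb)))))

  step-numBlocks : ∀ x y → Step x y → numBlocks x ≡ suc (numBlocks y)
  step-numBlocks x y (merge ka kb ka≢kb ua ub g e) =
    trans (numBlocks-delete x _ kb ub (merge-labels x ka kb g ua ka≢kb)) (cong suc (sym (numBlocks-≈ _ _ e)))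
  step-numBlocks x y (colour kb ub f _ e) =
    trans (numBlocks-delete x _ kb ub (colour-labels x kb f)) (cong suc (sym (numBlocks-≈ _ _ e)))

  Edge : Raw → Raw → Set
  Edge x y = (x ≈ y) ⊎ Step x y

  edge-numBlocks : ∀ x y → Edge x y → numBlocks y ≤ numBlocks x
  edge-numBlocks x y (inj₁ e)  = ≤-reflexive (sym (numBlocks-≈ x y e))
  edge-numBlocks x y (inj₂ st) = ≤-trans (n≤1+n _) (≤-reflexive (sym (step-numBlocks x y st)))

  ≤ᴰ-numBlocks : ∀ {x y} → x ≤ᴰ y → numBlocks y ≤ numBlocks x
  ≤ᴰ-numBlocks []                       = ≤-refl
  ≤ᴰ-numBlocks (_◅_ {j = x₁} e chain) = ≤-trans (≤ᴰ-numBlocks chain) (edge-numBlocks _ x₁ e)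

  -- ... and a chain that keeps it uses no step, so it stays in one ≈-class.
  ≤ᴰ-flat : ∀ {x y} w → w ≈ x → x ≤ᴰ y → numBlocks y ≡ numBlocks w → w ≈ y
  ≤ᴰ-flat w w≈x [] _ = w≈x
  ≤ᴰ-flat w w≈x (_◅_ {j = x₁} (inj₁ e) chain) q = ≤ᴰ-flat w (≈-trans w _ x₁ w≈x e) chain q
  ≤ᴰ-flat w w≈x (_◅_ {i = x} {j = x₁} (inj₂ st) chain) q =
    ⊥-elim (<⇒≱ (s≤s (≤ᴰ-numBlocks chain))
      (≤-reflexive (trans (sym (step-numBlocks x x₁ st)) (trans (sym (numBlocks-≈ w x w≈x)) (sym q)))))

  <ᴰ-numBlocks : ∀ x y → x <ᴰ y → numBlocks y < numBlocks x
  <ᴰ-numBlocks x y (x≤y , y≰x) with m≤n⇒m<n∨m≡n (≤ᴰ-numBlocks x≤y)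
  ... | inj₁ lt = lt
  ... | inj₂ eq = ⊥-elim (y≰x (inj₁ (≈-sym x y (≤ᴰ-flat x (≈-refl x) x≤y eq)) ◅ []))

  numBlocks-<ᴰ : ∀ x y → x ≤ᴰ y → numBlocks y < numBlocks x → x <ᴰ y
  numBlocks-<ᴰ x y x≤y lt = x≤y , λ y≤x → <⇒≱ lt (≤ᴰ-numBlocks y≤x)

  step-covers : ∀ x y → Step x y → x ⋖ y
  step-covers x y st = numBlocks-<ᴰ x y (inj₂ st ◅ []) (≤-reflexive (sym drop)) , no-middle
    where
    drop = step-numBlocks x y st
    no-middle : ¬ (Σ Raw λ w → (x <ᴰ w) × (w <ᴰ y))
    no-middle (w , x<w , w<y) =
      <⇒≱ (<ᴰ-numBlocks w y w<y) (≤-pred (subst (numBlocks w <_) drop (<ᴰ-numBlocks x w x<w)))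

  ≤ᴰ-one-step : ∀ {x z y} → x ≈ z → z ≤ᴰ y → suc (numBlocks y) ≡ numBlocks x →
    Σ Raw λ z' → Σ Raw λ z₁ → (x ≈ z') × Step z' z₁ × (z₁ ≈ y)
  ≤ᴰ-one-step {x} {z} x≈z [] q = ⊥-elim (1+n≢n (trans q (numBlocks-≈ x z x≈z)))
  ≤ᴰ-one-step {x} x≈z (_◅_ {j = z₁} (inj₁ e) chain) q = ≤ᴰ-one-step (≈-trans x _ z₁ x≈z e) chain q
  ≤ᴰ-one-step {x} x≈z (_◅_ {i = z} {j = z₁} (inj₂ st) chain) q =
    z , z₁ , x≈z , st ,
    ≤ᴰ-flat z₁ (≈-refl z₁) chain (suc-injective (trans q (trans (numBlocks-≈ x z x≈z) (step-numBlocks z z₁ st))))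

  InEither : Raw → Fin n → Fin n → Fin n → Set
  InEither x m₁ m₂ i = SameBlock x i m₁ ⊎ SameBlock x i m₂

  inEither? : ∀ x m₁ m₂ i → Dec (InEither x m₁ m₂ i)
  inEither? x m₁ m₂ i = sameBlock? x i m₁ ⊎-dec sameBlock? x i m₂

  InEither-transport : ∀ {x z} → SameBlocks x z → ∀ {m₁ m₂ i} → InEither x m₁ m₂ i → InEither z m₁ m₂ i
  InEither-transport h (inj₁ a) = inj₁ (proj₁ (h _ _) a)
  InEither-transport h (inj₂ a) = inj₂ (proj₁ (h _ _) a)

  InEither-move : ∀ x {m₁ m₂ i j} → SameBlock x i j → InEither x m₁ m₂ i → InEither x m₁ m₂ j
  InEither-move x sb (inj₁ a) = inj₁ (SameBlock-trans x (SameBlock-sym x sb) a)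
  InEither-move x sb (inj₂ a) = inj₂ (SameBlock-trans x (SameBlock-sym x sb) a)

  module MergeSpec (x : Raw) (ka kb : Fin n) (g : G) (ka≢kb : ¬ (ka ≡ kb))
                   (m₁ : Fin n) (l₁ : Label x m₁ ka) (m₂ : Fin n) (l₂ : Label x m₂ kb) where

    Y : Raw
    Y = mergeRaw x ka kb g

    zeros : ∀ j s → (Y j ≡ inj₁ s) ⇔ (x j ≡ inj₁ s)
    zeros j s = merge-zero⁻¹ x ka kb g j , merge-zero x ka kb g j

    label-moved : ∀ j {k} → Label x j k → k ≡ kb → Label Y j ka
    label-moved j (h , r) refl = h ∙ g , merge-moved x ka kb g j r

    label-other : ∀ j {k} → Label x j k → ¬ (k ≡ kb) → Label Y j k
    label-other j (h , r) k≢kb = h , merge-other x ka kb g j r k≢kb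

    InBlock⁻¹ : ∀ j → InBlock Y j → InBlock x j
    InBlock⁻¹ j (k , h , e) with shape (x j)
    ... | zero-entry s r = ⊥-elim (zero≢block (trans (sym (merge-zero x ka kb g j r)) e))
    ... | block-entry k' h' r = k' , h' , r

    label⁻¹ : ∀ j {k'} → Label Y j k' →
      Σ (Fin n) λ k → Label x j k × ((k ≡ kb × k' ≡ ka) ⊎ (¬ (k ≡ kb) × k' ≡ k))
    label⁻¹ j l with k , lx ← InBlock⁻¹ j (_ , l) | k ≟ kb
    ... | yes k≡kb = k , lx , inj₁ (k≡kb , Label-functional Y j l (label-moved j lx k≡kb))
    ... | no k≢kb  = k , lx , inj₂ (k≢kb , Label-functional Y j l (label-other j lx k≢kb))

    Merged : Fin n → Set
    Merged = InEither x m₁ m₂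

    Merged-label : ∀ i → Merged i → Label Y i ka
    Merged-label i (inj₁ (k , li , lm)) with refl ← Label-functional x m₁ lm l₁ = label-other i li ka≢kb
    Merged-label i (inj₂ (k , li , lm)) = label-moved i li (Label-functional x m₂ lm l₂)

    sameBlock : ∀ i j → SameBlock Y i j ⇔ (SameBlock x i j ⊎ (Merged i × Merged j))
    sameBlock i j = to , from
      where
      to : SameBlock Y i j → SameBlock x i j ⊎ (Merged i × Merged j)
      to (k' , li , lj) with label⁻¹ i li | label⁻¹ j lj
      ... | ki , lxi , inj₁ (a , b) | kj , lxj , inj₁ (c , d) =
        inj₁ (kb , subst (Label x i) a lxi , subst (Label x j) c lxj)
      ... | ki , lxi , inj₁ (a , b) | kj , lxj , inj₂ (c , d) =
        inj₂ (inj₂ (kb , subst (Label x i) a lxi , l₂) , inj₁ (ka , subst (Label x j) (trans (sym d) b) lxj , l₁))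
      ... | ki , lxi , inj₂ (a , b) | kj , lxj , inj₁ (c , d) =
        inj₂ (inj₁ (ka , subst (Label x i) (trans (sym b) d) lxi , l₁) , inj₂ (kb , subst (Label x j) c lxj , l₂))
      ... | ki , lxi , inj₂ (a , b) | kj , lxj , inj₂ (c , d) =
        inj₁ (ki , lxi , subst (Label x j) (trans (sym d) b) lxj)
      from : SameBlock x i j ⊎ (Merged i × Merged j) → SameBlock Y i j
      from (inj₁ (k , li , lj)) with k ≟ kb
      ... | yes k≡kb = ka , label-moved i li k≡kb , label-moved j lj k≡kb
      ... | no k≢kb  = k , label-other i li k≢kb , label-other j lj k≢kb
      from (inj₂ (mi , mj)) = ka , Merged-label i mi , Merged-label j mj

    col-moved : ∀ j {h} → Col x j h → SameBlock x j m₂ → Col Y j (h ∙ g)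
    col-moved j {h} (k , r) sb
      with refl ← trans (Label-functional x j (h , r) (proj₁ (proj₂ sb))) (Label-functional x m₂ (proj₂ (proj₂ sb)) l₂)
      = ka , merge-moved x ka kb g j r

    col-other : ∀ j {h} → Col x j h → ¬ (SameBlock x j m₂) → Col Y j h
    col-other j {h} (k , r) ∉m₂ with k ≟ kb
    ... | yes refl = ⊥-elim (∉m₂ (kb , (h , r) , l₂))
    ... | no k≢kb  = k , merge-other x ka kb g j r k≢kb

    colour⁻¹ : ∀ j {h'} → Col Y j h' →
      Σ G λ h → Col x j h × ((SameBlock x j m₂ × h' ≡ h ∙ g) ⊎ (¬ (SameBlock x j m₂) × h' ≡ h))
    colour⁻¹ j cy with h , cx ← InBlock⇒Col x (InBlock⁻¹ j (Col⇒InBlock Y cy)) | sameBlock? x j m₂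
    ... | yes sb  = h , cx , inj₁ (sb , Col-functional Y j cy (col-moved j cx sb))
    ... | no ∉m₂ = h , cx , inj₂ (∉m₂ , Col-functional Y j cy (col-other j cx ∉m₂))

  module ColourSpec (x : Raw) (kb : Fin n) (f : G → S) (m : Fin n) (lm : Label x m kb) where

    Y : Raw
    Y = colourRaw x kb f

    label-other : ∀ j {k} → Label x j k → ¬ (k ≡ kb) → Label Y j k
    label-other j (h , r) k≢kb = h , colour-other x kb f j r k≢kb

    entry⁻¹ : ∀ j {k h} → Y j ≡ inj₂ (k , h) → (x j ≡ inj₂ (k , h)) × ¬ (k ≡ kb)
    entry⁻¹ j e with shape (x j)
    ... | zero-entry s r = ⊥-elim (zero≢block (trans (sym (colour-zero x kb f j r)) e))
    ... | block-entry k' h' r with k' ≟ kb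
    ...   | yes refl = ⊥-elim (zero≢block (trans (sym (colour-moved x kb f j r)) e))
    ...   | no k'≢kb with refl ← trans (sym (colour-other x kb f j r k'≢kb)) e = r , k'≢kb

    label⁻¹ : ∀ j {k} → Label Y j k → Label x j k × ¬ (k ≡ kb)
    label⁻¹ j (h , e) = (h , proj₁ (entry⁻¹ j e)) , proj₂ (entry⁻¹ j e)

    sameBlock : ∀ i j → SameBlock Y i j ⇔ (SameBlock x i j × ¬ (SameBlock x i m))
    sameBlock i j = to , from
      where
      to : SameBlock Y i j → SameBlock x i j × ¬ (SameBlock x i m)
      to (k , li , lj) = (k , proj₁ (label⁻¹ i li) , proj₁ (label⁻¹ j lj)) ,
        λ (_ , li' , lm') → proj₂ (label⁻¹ i li)
          (trans (Label-functional x i (proj₁ (label⁻¹ i li)) li') (Label-functional x m lm' lm))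
      from : SameBlock x i j × ¬ (SameBlock x i m) → SameBlock Y i j
      from ((k , li , lj) , ∉m) = k , label-other i li k≢kb , label-other j lj k≢kb
        where k≢kb : ¬ (k ≡ kb)
              k≢kb refl = ∉m (kb , li , lm)

    colour⁻¹ : ∀ j {h} → Col Y j h → Col x j h
    colour⁻¹ j (k , e) = k , proj₁ (entry⁻¹ j e)

  choose : ∀ {P : Set} → Dec P → G → G → G
  choose (yes _) a b = a
  choose (no _)  a b = b

  choose-yes : ∀ {P : Set} (d : Dec P) a b → P → choose d a b ≡ a
  choose-yes (yes _) a b _ = refl
  choose-yes (no ¬p) a b p = ⊥-elim (¬p p)

  choose-no : ∀ {P : Set} (d : Dec P) a b → ¬ P → choose d a b ≡ b
  choose-no (yes p) a b ¬p = ⊥-elim (¬p p)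
  choose-no (no _)  a b _  = refl

  choose-cong : ∀ {P Q : Set} (d : Dec P) (d' : Dec Q) a b b' → (P → Q) → (Q → P) → b ≡ b' →
    choose d a b ≡ choose d' a b'
  choose-cong (yes p) (yes q) a b b' _ _ _ = refl
  choose-cong (yes p) (no ¬q) a b b' f _ _ = ⊥-elim (¬q (f p))
  choose-cong (no ¬p) (yes q) a b b' _ g _ = ⊥-elim (¬p (g q))
  choose-cong (no ¬p) (no ¬q) a b b' _ _ e = e

  ⇔-≡ : ∀ {a b : Entry} s → a ≡ b → (a ≡ inj₁ s) ⇔ (b ≡ inj₁ s)
  ⇔-≡ s refl = ⇔-refl

  ⇔-blocks : ∀ {a b : Entry} s {k h k' h'} → a ≡ inj₂ (k , h) → b ≡ inj₂ (k' , h') → (a ≡ inj₁ s) ⇔ (b ≡ inj₁ s)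
  ⇔-blocks s ra rb = (λ e → ⊥-elim (zero≢block (trans (sym e) ra))) , (λ e → ⊥-elim (zero≢block (trans (sym e) rb)))

  -- Sending corresponding blocks of equivalent representatives to the zero
  -- block gives the same zero colours, once the equivariant map absorbs the
  -- multiplier c: on that block the colours satisfy h' = h c, so f h' = h • f c.
  colour-transport-zeros : ∀ x z (e : x ≈ z) m ka kb → Label x m ka → Label z m kb → ∀ f → Equivariant f →
    ∀ j s → (colourRaw x ka (λ h → h • f (multiplier x z e m)) j ≡ inj₁ s) ⇔ (colourRaw z kb f j ≡ inj₁ s)
  colour-transport-zeros x z e m ka kb lx lz f equivariant j s with shape (x j)
  ... | zero-entry t r = ⇔-≡ s (trans (colour-zero x ka φ j r) (sym (colour-zero z kb f j (proj₁ (proj₁ e j t) r))))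
    where φ = λ h → h • f (multiplier x z e m)
  ... | block-entry k h r with shape (z j)
  ...   | zero-entry t r' = ⊥-elim (zero≢block (trans (sym (proj₂ (proj₁ e j t) r')) r))
  ...   | block-entry k' h' r' with k ≟ ka
  ...     | yes refl = ⇔-≡ s (trans (colour-moved x ka φ j r) (trans (cong inj₁ (sym fh')) (sym (colour-moved z kb f j r'z))))
    where
    c = multiplier x z e m
    φ = λ h → h • f c
    sbx : SameBlock x m j
    sbx = ka , lx , (h , r)
    k'≡kb : k' ≡ kb
    k'≡kb = let (_ , lm , lj) = proj₁ (≈⇒SameBlocks e m j) sbx in
            trans (Label-functional z j (h' , r') lj) (Label-functional z m lm lz)
    r'z : z j ≡ inj₂ (kb , h')
    r'z = subst (λ k'' → z j ≡ inj₂ (k'' , h')) k'≡kb r'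
    fh' : f h' ≡ h • f c
    fh' = trans (cong f (multiplier-block x z e m j sbx (ka , r) (kb , r'z))) (equivariant h c)
  ...     | no k≢ka = ⇔-blocks s (colour-other x ka _ j r k≢ka) (colour-other z kb f j r' k'≢kb)
    where
    k'≢kb : ¬ (k' ≡ kb)
    k'≢kb refl = let (_ , lj , lm) = proj₂ (≈⇒SameBlocks e j m) (kb , (h' , r') , lz) in
                 k≢ka (trans (Label-functional x j (h , r) lj) (Label-functional x m lm lx))

  colour-transport : ∀ x z (e : x ≈ z) m ka kb (lx : Label x m ka) (lz : Label z m kb) f → Equivariant f →
    colourRaw x ka (λ h → h • f (multiplier x z e m)) ≈ colourRaw z kb f
  colour-transport x z e m ka kb lx lz f equivariant =
    ≈-by-multiplier A B (colour-transport-zeros x z e m ka kb lx lz f equivariant) blocks (multiplier x z e) colours const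
    where
    A B : Raw
    A = colourRaw x ka (λ h → h • f (multiplier x z e m))
    B = colourRaw z kb f
    module CA = ColourSpec x ka (λ h → h • f (multiplier x z e m)) m lx
    module CB = ColourSpec z kb f m lz
    bx = ≈⇒SameBlocks e
    blocks : SameBlocks A B
    blocks i j =
      (λ sb → let (sbx , ∉m) = proj₁ (CA.sameBlock i j) sb in
              proj₂ (CB.sameBlock i j) (proj₁ (bx i j) sbx , λ s → ∉m (proj₂ (bx i m) s))) ,
      (λ sb → let (sbz , ∉m) = proj₁ (CB.sameBlock i j) sb in
              proj₂ (CA.sameBlock i j) (proj₂ (bx i j) sbz , λ s → ∉m (proj₁ (bx i m) s)))
    colours : ∀ i g h → Col A i g → Col B i h → h ≡ g ∙ multiplier x z e i
    colours i g h cg ch = multiplier-at x z e i (CA.colour⁻¹ i cg) (CB.colour⁻¹ i ch)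
    const : ∀ i j → SameBlock A i j → multiplier x z e i ≡ multiplier x z e j
    const i j sb = multiplier-const x z e i j (proj₁ (proj₁ (CA.sameBlock i j) sb))

  merge-partition : ∀ x z {ka kb ka' kb' m₁ m₂ m₁' m₂'} g g'
    (ka≢kb : ¬ (ka ≡ kb)) (l₁ : Label x m₁ ka) (l₂ : Label x m₂ kb)
    (ka'≢kb' : ¬ (ka' ≡ kb')) (l₁' : Label z m₁' ka') (l₂' : Label z m₂' kb') →
    (∀ j s → (x j ≡ inj₁ s) ⇔ (z j ≡ inj₁ s)) → SameBlocks x z →
    (∀ i → InEither x m₁ m₂ i ⇔ InEither z m₁' m₂' i) →
    (∀ j s → (mergeRaw x ka kb g j ≡ inj₁ s) ⇔ (mergeRaw z ka' kb' g' j ≡ inj₁ s)) ×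
    SameBlocks (mergeRaw x ka kb g) (mergeRaw z ka' kb' g')
  merge-partition x z g g' ka≢kb l₁ l₂ ka'≢kb' l₁' l₂' zeros blocks joined = zeros' , blocks'
    where
    module MX = MergeSpec x _ _ g ka≢kb _ l₁ _ l₂
    module MZ = MergeSpec z _ _ g' ka'≢kb' _ l₁' _ l₂'
    zeros' : ∀ j s → (MX.Y j ≡ inj₁ s) ⇔ (MZ.Y j ≡ inj₁ s)
    zeros' j s = (λ a → proj₂ (MZ.zeros j s) (proj₁ (zeros j s) (proj₁ (MX.zeros j s) a))) ,
                 (λ b → proj₂ (MX.zeros j s) (proj₂ (zeros j s) (proj₁ (MZ.zeros j s) b)))
    blocks' : SameBlocks MX.Y MZ.Y
    blocks' i j =
      (λ sb → proj₂ (MZ.sameBlock i j)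
        (map⊎ (proj₁ (blocks i j)) (λ (p , q) → proj₁ (joined i) p , proj₁ (joined j) q) (proj₁ (MX.sameBlock i j) sb))) ,
      (λ sb → proj₂ (MX.sameBlock i j)
        (map⊎ (proj₂ (blocks i j)) (λ (p , q) → proj₂ (joined i) p , proj₂ (joined j) q) (proj₁ (MZ.sameBlock i j) sb)))

  -- Merging corresponding blocks of equivalent representatives gives
  -- equivalent results, once the merge element absorbs the multipliers
  -- c₁, c₂ of the two blocks: g' = c₂ g c₁⁻¹.
  merge-transport : ∀ x z (e : x ≈ z) m₁ m₂ ka₁ ka₂ kb₁ kb₂ (lx₁ : Label x m₁ ka₁) (lx₂ : Label x m₂ ka₂)
    (lz₁ : Label z m₁ kb₁) (lz₂ : Label z m₂ kb₂) (kb₁≢kb₂ : ¬ (kb₁ ≡ kb₂)) (ka₁≢ka₂ : ¬ (ka₁ ≡ ka₂)) g →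
    mergeRaw x ka₁ ka₂ ((multiplier x z e m₂ ∙ g) ∙ multiplier x z e m₁ ⁻¹) ≈ mergeRaw z kb₁ kb₂ g
  merge-transport x z e m₁ m₂ ka₁ ka₂ kb₁ kb₂ lx₁ lx₂ lz₁ lz₂ kb₁≢kb₂ ka₁≢ka₂ g =
    ≈-by-multiplier A B (proj₁ partition) (proj₂ partition) c colours const
    where
    μ = multiplier x z e
    c₁ = μ m₁
    c₂ = μ m₂
    g' = (c₂ ∙ g) ∙ c₁ ⁻¹
    A B : Raw
    A = mergeRaw x ka₁ ka₂ g'
    B = mergeRaw z kb₁ kb₂ g
    module MA = MergeSpec x ka₁ ka₂ g' ka₁≢ka₂ m₁ lx₁ m₂ lx₂
    module MB = MergeSpec z kb₁ kb₂ g kb₁≢kb₂ m₁ lz₁ m₂ lz₂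
    bx = ≈⇒SameBlocks e
    partition = merge-partition x z g' g ka₁≢ka₂ lx₁ lx₂ kb₁≢kb₂ lz₁ lz₂ (proj₁ e) bx
      (λ i → InEither-transport bx , InEither-transport (SameBlocks-sym bx))
    -- on the merged block of A the multiplier is c₁, elsewhere that of e
    c : Fin n → G
    c i = choose (inEither? x m₁ m₂ i) c₁ (μ i)
    c-moved : ∀ i → SameBlock x i m₂ → c i ≡ c₁
    c-moved i s = choose-yes (inEither? x m₁ m₂ i) _ _ (inj₂ s)
    c-other : ∀ i → ¬ (SameBlock x i m₂) → c i ≡ μ i
    c-other i ∉m₂ with inEither? x m₁ m₂ i
    ... | yes (inj₁ s₁) = sym (multiplier-const x z e i m₁ s₁)
    ... | yes (inj₂ s₂) = ⊥-elim (∉m₂ s₂)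
    ... | no _ = refl
    colours : ∀ i gA hB → Col A i gA → Col B i hB → hB ≡ gA ∙ c i
    colours i gA hB ca cb with MA.colour⁻¹ i ca | MB.colour⁻¹ i cb
    ... | gx , cx , inj₁ (sx , ea) | hz , cz , inj₁ (_ , eb) = begin
      hB                    ≡⟨ eb ⟩
      hz ∙ g                ≡⟨ cong (_∙ g) (multiplier-at x z e i cx cz) ⟩
      (gx ∙ μ i) ∙ g        ≡⟨ cong (λ t → (gx ∙ t) ∙ g) (multiplier-const x z e i m₂ sx) ⟩
      (gx ∙ c₂) ∙ g         ≡⟨ assoc gx c₂ g ⟩
      gx ∙ (c₂ ∙ g)         ≡⟨ cong (gx ∙_) (//-rightDividesˡ c₁ (c₂ ∙ g)) ⟨
      gx ∙ (g' ∙ c₁)        ≡⟨ assoc gx g' c₁ ⟨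
      (gx ∙ g') ∙ c₁        ≡⟨ cong₂ _∙_ ea (c-moved i sx) ⟨
      gA ∙ c i              ∎
      where open ≡-Reasoning
    ... | _ , _ , inj₁ (sx , _) | _ , _ , inj₂ (∉m₂ , _) = ⊥-elim (∉m₂ (proj₁ (bx i m₂) sx))
    ... | _ , _ , inj₂ (∉m₂ , _) | _ , _ , inj₁ (sz , _) = ⊥-elim (∉m₂ (proj₂ (bx i m₂) sz))
    ... | gx , cx , inj₂ (∉m₂ , ea) | hz , cz , inj₂ (_ , eb) =
      trans eb (trans (multiplier-at x z e i cx cz) (sym (cong₂ _∙_ ea (c-other i ∉m₂))))
    const : ∀ i j → SameBlock A i j → c i ≡ c j
    const i j sb with proj₁ (MA.sameBlock i j) sb
    ... | inj₁ sbx = choose-cong (inEither? x m₁ m₂ i) (inEither? x m₁ m₂ j) c₁ (μ i) (μ j)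
                       (InEither-move x sbx) (InEither-move x (SameBlock-sym x sbx)) (multiplier-const x z e i j sbx)
    ... | inj₂ (mi , mj) = trans (choose-yes (inEither? x m₁ m₂ i) _ _ mi) (sym (choose-yes (inEither? x m₁ m₂ j) _ _ mj))

  merge-swap : ∀ x m₁ m₂ ka kb (l₁ : Label x m₁ ka) (l₂ : Label x m₂ kb) (ka≢kb : ¬ (ka ≡ kb)) g →
    mergeRaw x ka kb g ≈ mergeRaw x kb ka (g ⁻¹)
  merge-swap x m₁ m₂ ka kb l₁ l₂ ka≢kb g = ≈-by-multiplier A B (proj₁ partition) (proj₂ partition) c colours const
    where
    A B : Raw
    A = mergeRaw x ka kb g
    B = mergeRaw x kb ka (g ⁻¹)
    module MA = MergeSpec x ka kb g ka≢kb m₁ l₁ m₂ l₂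
    module MB = MergeSpec x kb ka (g ⁻¹) (λ e → ka≢kb (sym e)) m₂ l₂ m₁ l₁
    partition = merge-partition x x g (g ⁻¹) ka≢kb l₁ l₂ (λ e → ka≢kb (sym e)) l₂ l₁
      (λ _ _ → ⇔-refl) (λ _ _ → ⇔-refl) (λ _ → swap , swap)
    -- A and B differ by g⁻¹ on the merged block and agree elsewhere
    c : Fin n → G
    c i = choose (inEither? x m₁ m₂ i) (g ⁻¹) ε
    disjoint : ∀ i → SameBlock x i m₂ → SameBlock x i m₁ → ⊥
    disjoint i s₂ s₁ with _ , a , b ← SameBlock-trans x (SameBlock-sym x s₁) s₂ =
      ka≢kb (trans (Label-functional x m₁ l₁ a) (Label-functional x m₂ b l₂))
    colours : ∀ i gA hB → Col A i gA → Col B i hB → hB ≡ gA ∙ c i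
    colours i gA hB ca cb with MA.colour⁻¹ i ca | MB.colour⁻¹ i cb
    ... | _ , _ , inj₁ (s₂ , _) | _ , _ , inj₁ (s₁ , _) = ⊥-elim (disjoint i s₂ s₁)
    ... | gx , cx , inj₁ (s₂ , ea) | _ , cx' , inj₂ (_ , eb) =
      trans eb (trans (Col-functional x i cx' cx)
        (sym (trans (cong₂ _∙_ ea (choose-yes (inEither? x m₁ m₂ i) _ _ (inj₂ s₂))) (//-rightDividesʳ g gx))))
    ... | gx , cx , inj₂ (_ , ea) | _ , cx' , inj₁ (s₁ , eb) =
      trans eb (trans (cong (_∙ g ⁻¹) (Col-functional x i cx' cx))
        (sym (cong₂ _∙_ ea (choose-yes (inEither? x m₁ m₂ i) _ _ (inj₁ s₁)))))
    ... | gx , cx , inj₂ (∉m₂ , ea) | _ , cx' , inj₂ (∉m₁ , eb) =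
      trans eb (trans (Col-functional x i cx' cx)
        (sym (trans (cong₂ _∙_ ea (choose-no (inEither? x m₁ m₂ i) _ _ (λ { (inj₁ a) → ∉m₁ a ; (inj₂ b) → ∉m₂ b }))) (identityʳ gx))))
    const : ∀ i j → SameBlock A i j → c i ≡ c j
    const i j sb with proj₁ (MA.sameBlock i j) sb
    ... | inj₁ sbx = choose-cong (inEither? x m₁ m₂ i) (inEither? x m₁ m₂ j) _ _ _
                       (InEither-move x sbx) (InEither-move x (SameBlock-sym x sbx)) refl
    ... | inj₂ (mi , mj) = trans (choose-yes (inEither? x m₁ m₂ i) _ _ mi) (sym (choose-yes (inEither? x m₁ m₂ j) _ _ mj))

  -- h ↦ h • s is the equivariant map G → S with 1 ↦ s; every equivariant
  -- map is of this form, so colourings are indexed by S.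
  orbitMap : S → G → S
  orbitMap s h = h • s

  orbitMap-equivariant : ∀ s → Equivariant (orbitMap s)
  orbitMap-equivariant s g h = act-∙ g h s

  •-injective : ∀ h {s s'} → h • s ≡ h • s' → s ≡ s'
  •-injective h {s} {s'} e = trans (sym (undo s)) (trans (cong (h ⁻¹ •_) e) (undo s'))
    where
    undo : ∀ t → h ⁻¹ • (h • t) ≡ t
    undo t = trans (sym (act-∙ (h ⁻¹) h t)) (trans (cong (_• t) (inverseˡ h)) (act-ε t))

  InBlock-≈ : ∀ x z → x ≈ z → ∀ {m kb} → Label z m kb → InBlock x m
  InBlock-≈ x z e l = SameBlock⇒InBlock x (proj₂ (≈⇒SameBlocks e _ _) (SameBlock-refl z (_ , l)))

  module Covers (x : Raw) where

    ℓ : ℕ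
    ℓ = numBlocks x

    lab : Fin ℓ → Fin n
    lab = select (usedᵇ x)

    lab-used : ∀ a → LabelUsed x (lab a)
    lab-used a = usedᵇ-sound x (lab a) (select-sound (usedᵇ x) a)

    lab-injective : ∀ {a b} → lab a ≡ lab b → a ≡ b
    lab-injective {a} {b} = select-injective (usedᵇ x) a b

    lab-onto : ∀ k → LabelUsed x k → Σ (Fin ℓ) λ a → lab a ≡ k
    lab-onto k used = select-complete (usedᵇ x) k (usedᵇ-complete x k used)

    <⇒lab≢ : ∀ {a b : Fin ℓ} → toℕ a < toℕ b → ¬ (lab a ≡ lab b)
    <⇒lab≢ lt e with refl ← lab-injective e = <-irrefl refl lt

    rep : Fin ℓ → Fin n
    rep a = witness x (lab a)

    rep-label : ∀ a → Label x (rep a) (lab a)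
    rep-label a = witness-label x (lab a) (lab-used a)

    rep-SameBlock : ∀ {a b} → SameBlock x (rep a) (rep b) → a ≡ b
    rep-SameBlock {a} {b} (_ , la , lb) =
      lab-injective (trans (Label-functional x (rep a) (rep-label a) la) (Label-functional x (rep b) lb (rep-label b)))

    CoverIndex : Set
    CoverIndex = (Fin ℓ × S) ⊎ (Pairs ℓ × G)

    cover : CoverIndex → Raw
    cover (inj₁ (a , s))               = colourRaw x (lab a) (orbitMap s)
    cover (inj₂ (((a , b) , _) , g)) = mergeRaw x (lab a) (lab b) g

    cover-step : ∀ j → Step x (cover j)
    cover-step (inj₁ (a , s)) = colour (lab a) (lab-used a) (orbitMap s) (orbitMap-equivariant s) (≈-refl _)
    cover-step (inj₂ (((a , b) , lt) , g)) = merge (lab a) (lab b) (<⇒lab≢ lt) (lab-used a) (lab-used b) g (≈-refl _)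

    cover-numBlocks : ∀ j → numBlocks x ≡ suc (numBlocks (cover j))
    cover-numBlocks j = step-numBlocks x (cover j) (cover-step j)

    step⇒cover : ∀ z z₁ → x ≈ z → Step z z₁ → Σ CoverIndex λ j → z₁ ≈ cover j
    step⇒cover z z₁ e (colour kb (m , lz) f equivariant z₁≈)
      with ka , lx ← InBlock-≈ x z e lz
      with a , refl ← lab-onto ka (m , lx) =
      inj₁ (a , f (multiplier x z e m)) ,
      ≈-trans z₁ _ _ z₁≈ (≈-sym _ _ (colour-transport x z e m (lab a) kb lx lz f equivariant))
    step⇒cover z z₁ e (merge kb₁ kb₂ kb₁≢kb₂ (m₁ , lz₁) (m₂ , lz₂) g z₁≈)
      with ka₁ , lx₁ ← InBlock-≈ x z e lz₁ | ka₂ , lx₂ ← InBlock-≈ x z e lz₂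
      with a₁ , refl ← lab-onto ka₁ (m₁ , lx₁) | a₂ , refl ← lab-onto ka₂ (m₂ , lx₂) = ordered (<-cmp (toℕ a₁) (toℕ a₂))
      where
      lab₁≢lab₂ : ¬ (lab a₁ ≡ lab a₂)
      lab₁≢lab₂ eq with _ , l₁ , l₂ ← proj₁ (≈⇒SameBlocks e m₁ m₂) (lab a₁ , lx₁ , subst (Label x m₂) (sym eq) lx₂) =
        kb₁≢kb₂ (trans (Label-functional z m₁ lz₁ l₁) (Label-functional z m₂ l₂ lz₂))
      g' = (multiplier x z e m₂ ∙ g) ∙ multiplier x z e m₁ ⁻¹
      z₁≈merge : z₁ ≈ mergeRaw x (lab a₁) (lab a₂) g'
      z₁≈merge = ≈-trans z₁ _ _ z₁≈
        (≈-sym _ _ (merge-transport x z e m₁ m₂ (lab a₁) (lab a₂) kb₁ kb₂ lx₁ lx₂ lz₁ lz₂ kb₁≢kb₂ lab₁≢lab₂ g))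
      ordered : Tri (toℕ a₁ < toℕ a₂) (toℕ a₁ ≡ toℕ a₂) (toℕ a₂ < toℕ a₁) → Σ CoverIndex λ j → z₁ ≈ cover j
      ordered (tri< lt _ _) = inj₂ (((a₁ , a₂) , lt) , g') , z₁≈merge
      ordered (tri≈ _ eq _) = ⊥-elim (lab₁≢lab₂ (cong lab (toℕ-injective eq)))
      ordered (tri> _ _ gt) = inj₂ (((a₂ , a₁) , gt) , g' ⁻¹) ,
        ≈-trans z₁ _ _ z₁≈merge (merge-swap x m₁ m₂ (lab a₁) (lab a₂) lx₁ lx₂ lab₁≢lab₂ g')

    colour-at-rep : ∀ a s → cover (inj₁ (a , s)) (rep a) ≡ inj₁ (proj₁ (rep-label a) • s)
    colour-at-rep a s = colour-moved x (lab a) (orbitMap s) (rep a) (proj₂ (rep-label a))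

    colour≉merge : ∀ a s p g → ¬ (cover (inj₁ (a , s)) ≈ cover (inj₂ (p , g)))
    colour≉merge a s ((a' , b') , _) g (zeros , _) =
      zero≢block (trans (sym (merge-zero⁻¹ x (lab a') (lab b') g (rep a) (proj₁ (zeros (rep a) _) (colour-at-rep a s))))
                        (proj₂ (rep-label a)))

    colour-determined : ∀ a a' s s' → cover (inj₁ (a , s)) ≈ cover (inj₁ (a' , s')) → (a , s) ≡ (a' , s')
    colour-determined a a' s s' (zeros , _) with a ≟ a'
    ... | yes refl = cong (a ,_) (•-injective (proj₁ (rep-label a))
          (zero-injective (trans (sym (proj₁ (zeros (rep a) _) (colour-at-rep a s))) (colour-at-rep a s'))))
    ... | no a≢a' = ⊥-elim (zero≢block (trans (sym (proj₁ (zeros (rep a) _) (colour-at-rep a s)))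
          (colour-other x (lab a') _ (rep a) (proj₂ (rep-label a)) (λ eq → a≢a' (lab-injective eq)))))

    -- A merge determines the pair of merged blocks: they are the only two
    -- blocks of x whose representatives become joined.
    merge-pair-determined : ∀ a b a' b' (lt : toℕ a < toℕ b) (lt' : toℕ a' < toℕ b') g g' →
      mergeRaw x (lab a) (lab b) g ≈ mergeRaw x (lab a') (lab b') g' → (a ≡ a') × (b ≡ b')
    merge-pair-determined a b a' b' lt lt' g g' e = from-joined (proj₁ (MB.sameBlock (rep a) (rep b)) joinedB)
      where
      module MA = MergeSpec x (lab a) (lab b) g (<⇒lab≢ lt) (rep a) (rep-label a) (rep b) (rep-label b)
      module MB = MergeSpec x (lab a') (lab b') g' (<⇒lab≢ lt') (rep a') (rep-label a') (rep b') (rep-label b')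
      joinedA = proj₂ (MA.sameBlock (rep a) (rep b))
        (inj₂ (inj₁ (SameBlock-refl x (_ , rep-label a)) , inj₂ (SameBlock-refl x (_ , rep-label b))))
      joinedB = proj₁ (≈⇒SameBlocks e (rep a) (rep b)) joinedA
      which : ∀ {c} → MB.Merged (rep c) → (c ≡ a') ⊎ (c ≡ b')
      which (inj₁ s) = inj₁ (rep-SameBlock s)
      which (inj₂ s) = inj₂ (rep-SameBlock s)
      sorted : (a ≡ a') ⊎ (a ≡ b') → (b ≡ a') ⊎ (b ≡ b') → (a ≡ a') × (b ≡ b')
      sorted (inj₁ refl) (inj₁ refl) = ⊥-elim (<-irrefl refl lt)
      sorted (inj₁ ea)   (inj₂ eb)   = ea , eb
      sorted (inj₂ refl) (inj₁ refl) = ⊥-elim (<-asym lt lt')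
      sorted (inj₂ refl) (inj₂ refl) = ⊥-elim (<-irrefl refl lt)
      from-joined : SameBlock x (rep a) (rep b) ⊎ (MB.Merged (rep a) × MB.Merged (rep b)) → (a ≡ a') × (b ≡ b')
      from-joined (inj₁ s) with refl ← rep-SameBlock s = ⊥-elim (<-irrefl refl lt)
      from-joined (inj₂ (ma , mb)) = sorted (which ma) (which mb)

    -- For a fixed pair, the merge determines g: the multiplier of the
    -- equivalence is 1 on the block lab a, hence also on the joined block.
    merge-element-determined : ∀ a b (lt : toℕ a < toℕ b) g g' →
      mergeRaw x (lab a) (lab b) g ≈ mergeRaw x (lab a) (lab b) g' → g ≡ g'
    merge-element-determined a b lt g g' (_ , _ , colours) =
      sym (∙-cancelˡ hb g' g (trans at-b (trans (cong ((hb ∙ g) ∙_) c≡ε) (identityʳ _))))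
      where
      module MA = MergeSpec x (lab a) (lab b) g (<⇒lab≢ lt) (rep a) (rep-label a) (rep b) (rep-label b)
      module MB = MergeSpec x (lab a) (lab b) g' (<⇒lab≢ lt) (rep a) (rep-label a) (rep b) (rep-label b)
      ha = proj₁ (rep-label a)
      hb = proj₁ (rep-label b)
      ra = SameBlock-refl x (_ , rep-label a)
      rb = SameBlock-refl x (_ , rep-label b)
      joined = proj₂ (MA.sameBlock (rep a) (rep b)) (inj₂ (inj₁ ra , inj₂ rb))
      inA = SameBlock⇒InBlock MA.Y joined
      c = proj₁ (colours (rep a) inA)
      a∉b : ¬ (SameBlock x (rep a) (rep b))
      a∉b s = <-irrefl (cong toℕ (rep-SameBlock s)) lt
      at-a : ha ≡ ha ∙ c
      at-a = proj₂ (colours (rep a) inA) (rep a) ha ha (SameBlock-refl MA.Y inA)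
        (MA.col-other (rep a) (_ , proj₂ (rep-label a)) a∉b) (MB.col-other (rep a) (_ , proj₂ (rep-label a)) a∉b)
      c≡ε : c ≡ ε
      c≡ε = sym (∙-cancelˡ ha ε c (trans (identityʳ ha) at-a))
      at-b : hb ∙ g' ≡ (hb ∙ g) ∙ c
      at-b = proj₂ (colours (rep a) inA) (rep b) (hb ∙ g) (hb ∙ g') joined
        (MA.col-moved (rep b) (_ , proj₂ (rep-label b)) rb) (MB.col-moved (rep b) (_ , proj₂ (rep-label b)) rb)

    cover-injective : ∀ j j' → cover j ≈ cover j' → j ≡ j'
    cover-injective (inj₁ (a , s)) (inj₁ (a' , s')) e = cong inj₁ (colour-determined a a' s s' e)
    cover-injective (inj₁ (a , s)) (inj₂ (p , g))   e = ⊥-elim (colour≉merge a s p g e)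
    cover-injective (inj₂ (p , g)) (inj₁ (a , s))   e = ⊥-elim (colour≉merge a s p g (≈-sym _ _ e))
    cover-injective (inj₂ (((a , b) , lt) , g)) (inj₂ (((a' , b') , lt') , g')) e
      with refl , refl ← merge-pair-determined a b a' b' lt lt' g g' e =
      cong₂ (λ p h → inj₂ (p , h)) (pairs-≡ _ _ refl) (merge-element-determined a b lt g g' e)

    covers : ∀ j → x ⋖ cover j
    covers j = step-covers x (cover j) (cover-step j)

    cover-onto : ∀ y → x ≤ᴰ y → suc (numBlocks y) ≡ numBlocks x → Σ CoverIndex λ j → y ≈ cover j
    cover-onto y x≤y drop
      with z , z₁ , x≈z , st , z₁≈y ← ≤ᴰ-one-step (≈-refl x) x≤y drop
      with j , z₁≈ ← step⇒cover z z₁ x≈z st = j , ≈-trans y z₁ _ (≈-sym z₁ y z₁≈y) z₁≈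

    coverIndex↔ : Fin (ℓ * size + (ℓ C 2) * order) ↔ CoverIndex
    coverIndex↔ = ↔-trans +↔⊎ (*↔× ⊎-↔ ↔-trans *↔× (pairs↔ ℓ ×-↔ ↔-refl))

  αzero-at : ∀ i s → αzero i s i ≡ inj₁ s
  αzero-at i s with i ≟ i
  ... | yes _ = refl
  ... | no i≢i = ⊥-elim (i≢i refl)

  αzero-other : ∀ i s m → ¬ (m ≡ i) → αzero i s m ≡ inj₂ (m , ε)
  αzero-other i s m m≢i with m ≟ i
  ... | yes m≡i = ⊥-elim (m≢i m≡i)
  ... | no _ = refl

  αzero-block : ∀ i s m {k h} → αzero i s m ≡ inj₂ (k , h) → ¬ (m ≡ i) × (k ≡ m) × (h ≡ ε)
  αzero-block i s m e with m ≟ i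
  αzero-block i s m ()   | yes _
  αzero-block i s m refl | no m≢i = m≢i , refl , refl

  αpair-at-i : ∀ i j g → αpair i j g i ≡ inj₂ (i , ε)
  αpair-at-i i j g with i ≟ i
  ... | yes _ = refl
  ... | no i≢i = ⊥-elim (i≢i refl)

  αpair-at-j : ∀ i j g → ¬ (j ≡ i) → αpair i j g j ≡ inj₂ (i , g)
  αpair-at-j i j g j≢i with j ≟ i | j ≟ j
  ... | yes j≡i | _     = ⊥-elim (j≢i j≡i)
  ... | no _    | yes _ = refl
  ... | no _    | no j≢j = ⊥-elim (j≢j refl)

  αpair-other : ∀ i j g m → ¬ (m ≡ i) → ¬ (m ≡ j) → αpair i j g m ≡ inj₂ (m , ε)
  αpair-other i j g m m≢i m≢j with m ≟ i | m ≟ j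
  ... | yes m≡i | _       = ⊥-elim (m≢i m≡i)
  ... | no _    | yes m≡j = ⊥-elim (m≢j m≡j)
  ... | no _    | no _    = refl

  αpair-block : ∀ i j g m {k h} → αpair i j g m ≡ inj₂ (k , h) →
    (m ≡ i × k ≡ i × h ≡ ε) ⊎ ((m ≡ j × ¬ (m ≡ i) × k ≡ i × h ≡ g) ⊎ (¬ (m ≡ i) × ¬ (m ≡ j) × k ≡ m × h ≡ ε))
  αpair-block i j g m e with m ≟ i | m ≟ j
  αpair-block i j g m refl | yes m≡i | _       = inj₁ (m≡i , refl , refl)
  αpair-block i j g m refl | no m≢i  | yes m≡j = inj₂ (inj₁ (m≡j , m≢i , refl , refl))
  αpair-block i j g m refl | no m≢i  | no m≢j  = inj₂ (inj₂ (m≢i , m≢j , refl , refl))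

  αpair-nonzero : ∀ i j g m s → ¬ (αpair i j g m ≡ inj₁ s)
  αpair-nonzero i j g m s e with m ≟ i | m ≟ j
  αpair-nonzero i j g m s () | yes _ | _
  αpair-nonzero i j g m s () | no _  | yes _
  αpair-nonzero i j g m s () | no _  | no _

  discrete : Raw
  discrete m = inj₂ (m , ε)

  numBlocks-discrete : numBlocks discrete ≡ n
  numBlocks-discrete =
    trans (countFin-cong _ _ (λ k → usedᵇ-complete discrete k (k , ε , refl))) (countFin-all n)

  rank-one-by-deletion : ∀ y k → (∀ k' → LabelUsed y k' ⇔ (LabelUsed discrete k' × ¬ (k' ≡ k))) → rk y ≡ 1
  rank-one-by-deletion y k h =
    trans (cong (_∸ numBlocks y) (trans (sym numBlocks-discrete) (numBlocks-delete discrete y k (k , ε , refl) h)))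
          (m+n∸n≡m 1 (numBlocks y))

  -- The atoms delete one label of the discrete element: i, resp. j.
  rk-αzero : ∀ i s → rk (αzero i s) ≡ 1
  rk-αzero i s = rank-one-by-deletion (αzero i s) i λ k →
    (λ (m , h , e) → let (m≢i , k≡m , _) = αzero-block i s m e in (k , ε , refl) , λ k≡i → m≢i (trans (sym k≡m) k≡i)) ,
    (λ (_ , k≢i) → k , ε , αzero-other i s k k≢i)

  rk-αpair : ∀ i j g → toℕ i < toℕ j → rk (αpair i j g) ≡ 1
  rk-αpair i j g lt = rank-one-by-deletion (αpair i j g) j λ k → to k , from k
    where
    i≢j : ¬ (i ≡ j)
    i≢j e = <-irrefl (cong toℕ e) lt
    to : ∀ k → LabelUsed (αpair i j g) k → LabelUsed discrete k × ¬ (k ≡ j)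
    to k (m , h , e) with αpair-block i j g m e
    ... | inj₁ (_ , refl , _)              = (k , ε , refl) , i≢j
    ... | inj₂ (inj₁ (_ , _ , refl , _))   = (k , ε , refl) , i≢j
    ... | inj₂ (inj₂ (_ , m≢j , refl , _)) = (k , ε , refl) , m≢j
    from : ∀ k → LabelUsed discrete k × ¬ (k ≡ j) → LabelUsed (αpair i j g) k
    from k (_ , k≢j) with k ≟ i
    ... | yes refl = i , ε , αpair-at-i i j g
    ... | no k≢i   = k , ε , αpair-other i j g k k≢i k≢j

  rk-≈ : ∀ x y → x ≈ y → rk x ≡ rk y
  rk-≈ x y e = cong (n ∸_) (numBlocks-≈ x y e)

  colourAt : Raw → Fin n → G
  colourAt x m with shape (x m)
  ... | zero-entry _ _    = ε
  ... | block-entry _ g _ = g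

  colourAt-sound : ∀ x m {g} → Col x m g → colourAt x m ≡ g
  colourAt-sound x m (k , e) with shape (x m)
  ... | zero-entry s r      = ⊥-elim (zero≢block (trans (sym r) e))
  ... | block-entry k' g' r = colour-injective (trans (sym r) e)

  ≈-αzero : ∀ x i₀ s → x i₀ ≡ inj₁ s → (∀ m → ¬ (m ≡ i₀) → InBlock x m) →
    (∀ a b → SameBlock x a b → a ≡ b) → x ≈ αzero i₀ s
  ≈-αzero x i₀ s x-i₀ inBlock singletons =
    ≈-by-multiplier x (αzero i₀ s) zeros blocks (λ m → colourAt x m ⁻¹) colours const
    where
    zeros : ∀ m t → (x m ≡ inj₁ t) ⇔ (αzero i₀ s m ≡ inj₁ t)
    zeros m t = by-cases (m ≟ i₀)
      where
      by-cases : Dec (m ≡ i₀) → (x m ≡ inj₁ t) ⇔ (αzero i₀ s m ≡ inj₁ t)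
      by-cases (yes refl) = ⇔-≡ t (trans x-i₀ (sym (αzero-at i₀ s)))
      by-cases (no m≢i₀)  = ⇔-blocks t (proj₂ (proj₂ (inBlock m m≢i₀))) (αzero-other i₀ s m m≢i₀)
    not-i₀ : ∀ a → InBlock x a → ¬ (a ≡ i₀)
    not-i₀ a ib refl = InBlock⇒nonzero x s ib x-i₀
    blocks : SameBlocks x (αzero i₀ s)
    blocks a b = to , from
      where
      to : SameBlock x a b → SameBlock (αzero i₀ s) a b
      to sb with refl ← singletons a b sb =
        let a≢i₀ = not-i₀ a (SameBlock⇒InBlock x sb) in a , (ε , αzero-other i₀ s a a≢i₀) , (ε , αzero-other i₀ s a a≢i₀)
      from : SameBlock (αzero i₀ s) a b → SameBlock x a b
      from (_ , (_ , e) , (_ , e')) with αzero-block i₀ s a e | αzero-block i₀ s b e'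
      ... | a≢i₀ , refl , _ | _ , refl , _ = SameBlock-refl x (inBlock a a≢i₀)
    colours : ∀ m g h → Col x m g → Col (αzero i₀ s) m h → h ≡ g ∙ colourAt x m ⁻¹
    colours m g h cg (_ , e) =
      trans (proj₂ (proj₂ (αzero-block i₀ s m e))) (sym (trans (cong (λ t → g ∙ t ⁻¹) (colourAt-sound x m cg)) (inverseʳ g)))
    const : ∀ a b → SameBlock x a b → colourAt x a ⁻¹ ≡ colourAt x b ⁻¹
    const a b sb = cong (λ m → colourAt x m ⁻¹) (singletons a b sb)

  OnPair : Fin n → Fin n → Fin n → Set
  OnPair p q m = (m ≡ p) ⊎ (m ≡ q)

  αpair-sameBlock : ∀ p q r → ¬ (q ≡ p) → ∀ a b →
    SameBlock (αpair p q r) a b ⇔ ((a ≡ b) ⊎ (OnPair p q a × OnPair p q b))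
  αpair-sameBlock p q r q≢p a b = to , from
    where
    B = αpair p q r
    label-on : ∀ m → OnPair p q m → Label B m p
    label-on m (inj₁ refl) = ε , αpair-at-i p q r
    label-on m (inj₂ refl) = r , αpair-at-j p q r q≢p
    label-own : ∀ m → ¬ OnPair p q m → Label B m m
    label-own m off = ε , αpair-other p q r m (λ e → off (inj₁ e)) (λ e → off (inj₂ e))
    label⁻¹ : ∀ m {k h} → B m ≡ inj₂ (k , h) → (OnPair p q m × k ≡ p) ⊎ (¬ OnPair p q m × k ≡ m)
    label⁻¹ m e with αpair-block p q r m e
    ... | inj₁ (m≡p , k≡p , _)               = inj₁ (inj₁ m≡p , k≡p)
    ... | inj₂ (inj₁ (m≡q , _ , k≡p , _))   = inj₁ (inj₂ m≡q , k≡p)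
    ... | inj₂ (inj₂ (m≢p , m≢q , k≡m , _)) = inj₂ ((λ { (inj₁ e) → m≢p e ; (inj₂ e) → m≢q e }) , k≡m)
    to : SameBlock B a b → (a ≡ b) ⊎ (OnPair p q a × OnPair p q b)
    to (_ , (_ , e) , (_ , e')) with label⁻¹ a e | label⁻¹ b e'
    ... | inj₁ (pa , _)     | inj₁ (pb , _)     = inj₂ (pa , pb)
    ... | inj₁ (pa , refl)  | inj₂ (off , refl) = ⊥-elim (off (inj₁ refl))
    ... | inj₂ (off , refl) | inj₁ (pb , refl)  = ⊥-elim (off (inj₁ refl))
    ... | inj₂ (_ , refl)   | inj₂ (_ , refl)   = inj₁ refl
    from : (a ≡ b) ⊎ (OnPair p q a × OnPair p q b) → SameBlock B a b
    from (inj₁ refl) with (a ≟ p) ⊎-dec (a ≟ q)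
    ... | yes on = p , label-on a on , label-on a on
    ... | no off = a , label-own a off , label-own a off
    from (inj₂ (pa , pb)) = p , label-on a pa , label-on b pb

  ≈-αpair : ∀ x p q → toℕ p < toℕ q → (∀ m → InBlock x m) → SameBlock x p q →
    (∀ a b → SameBlock x a b → (a ≡ b) ⊎ (OnPair p q a × OnPair p q b)) →
    x ≈ αpair p q (colourAt x q ∙ colourAt x p ⁻¹)
  ≈-αpair x p q lt inBlock p~q blocks-of-x = ≈-by-multiplier x B zeros blocks c colours const
    where
    r = colourAt x q ∙ colourAt x p ⁻¹
    B = αpair p q r
    q≢p : ¬ (q ≡ p)
    q≢p e = <-irrefl (cong toℕ (sym e)) lt
    zeros : ∀ m t → (x m ≡ inj₁ t) ⇔ (B m ≡ inj₁ t)
    zeros m t = (λ e → ⊥-elim (InBlock⇒nonzero x t (inBlock m) e)) , (λ e → ⊥-elim (αpair-nonzero p q r m t e))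
    sameBlock-x : ∀ a b → (a ≡ b) ⊎ (OnPair p q a × OnPair p q b) → SameBlock x a b
    sameBlock-x a b (inj₁ refl)                    = SameBlock-refl x (inBlock a)
    sameBlock-x a b (inj₂ (inj₁ refl , inj₁ refl)) = SameBlock-refl x (inBlock a)
    sameBlock-x a b (inj₂ (inj₁ refl , inj₂ refl)) = p~q
    sameBlock-x a b (inj₂ (inj₂ refl , inj₁ refl)) = SameBlock-sym x p~q
    sameBlock-x a b (inj₂ (inj₂ refl , inj₂ refl)) = SameBlock-refl x (inBlock a)
    blocks : SameBlocks x B
    blocks a b = (λ sb → proj₂ (αpair-sameBlock p q r q≢p a b) (blocks-of-x a b sb)) ,
                 (λ sb → sameBlock-x a b (proj₁ (αpair-sameBlock p q r q≢p a b) sb))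
    -- the colours of p and q become 1 and r; every other colour becomes 1
    on? : ∀ m → Dec (OnPair p q m)
    on? m = (m ≟ p) ⊎-dec (m ≟ q)
    c : Fin n → G
    c m = choose (on? m) (colourAt x p ⁻¹) (colourAt x m ⁻¹)
    colours : ∀ m g h → Col x m g → Col B m h → h ≡ g ∙ c m
    colours m g h cg (_ , e) with αpair-block p q r m e
    ... | inj₁ (refl , _ , refl) =
      sym (trans (cong₂ _∙_ (sym (colourAt-sound x m cg)) (choose-yes (on? m) _ _ (inj₁ refl))) (inverseʳ _))
    ... | inj₂ (inj₁ (refl , _ , _ , refl)) =
      sym (cong₂ _∙_ (sym (colourAt-sound x m cg)) (choose-yes (on? m) _ _ (inj₂ refl)))
    ... | inj₂ (inj₂ (m≢p , m≢q , _ , refl)) =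
      sym (trans (cong₂ _∙_ (sym (colourAt-sound x m cg)) (choose-no (on? m) _ _ λ { (inj₁ e) → m≢p e ; (inj₂ e) → m≢q e }))
                 (inverseʳ _))
    const : ∀ a b → SameBlock x a b → c a ≡ c b
    const a b sb with blocks-of-x a b sb
    ... | inj₁ refl = refl
    ... | inj₂ (pa , pb) = trans (choose-yes (on? a) _ _ pa) (sym (choose-yes (on? b) _ _ pb))

  -- isWitnessᵇ x i: i lies in a block and is the chosen witness of it.
  -- Every block has exactly one witness, so the witnesses count the blocks.
  isWitnessᵇ : Raw → Fin n → Bool
  isWitnessᵇ x i = at (x i)
    where at : Entry → Bool
          at (inj₁ _)       = false
          at (inj₂ (k , _)) = ⌊ witness x k ≟ i ⌋

  isWitness-sound : ∀ x i → isWitnessᵇ x i ≡ true → Σ (Fin n) λ k → Label x i k × (witness x k ≡ i)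
  isWitness-sound x i e with x i
  ... | inj₂ (k , g) with witness x k ≟ i
  ...   | yes w≡i = k , (g , refl) , w≡i

  isWitness-complete : ∀ x i {k g} → x i ≡ inj₂ (k , g) → witness x k ≡ i → isWitnessᵇ x i ≡ true
  isWitness-complete x i {k} e w≡i rewrite e with witness x k ≟ i
  ... | yes _ = refl
  ... | no w≢i = ⊥-elim (w≢i w≡i)

  witnesses-apart : ∀ x a b → isWitnessᵇ x a ≡ true → isWitnessᵇ x b ≡ true → SameBlock x a b → a ≡ b
  witnesses-apart x a b wa wb (_ , la , lb)
    with ka , la' , w≡a ← isWitness-sound x a wa | kb , lb' , w≡b ← isWitness-sound x b wb =
    trans (sym w≡a) (trans (cong (witness x) (trans (Label-functional x a la' la) (Label-functional x b lb lb'))) w≡b)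

  numBlocks-witnesses : ∀ x → numBlocks x ≡ countFin (isWitnessᵇ x)
  numBlocks-witnesses x =
    ≤-antisym (countFin-injection (usedᵇ x) (isWitnessᵇ x) (witness x) to-witness witness-injective)
              (countFin-injection (isWitnessᵇ x) (usedᵇ x) label-of to-label label-of-injective)
    where
    wl = λ k u → witness-label x k (usedᵇ-sound x k u)
    to-witness : ∀ k → usedᵇ x k ≡ true → isWitnessᵇ x (witness x k) ≡ true
    to-witness k u = isWitness-complete x (witness x k) (proj₂ (wl k u)) refl
    witness-injective : ∀ k k' → usedᵇ x k ≡ true → usedᵇ x k' ≡ true → witness x k ≡ witness x k' → k ≡ k'
    witness-injective k k' u u' e =
      Label-functional x (witness x k) (wl k u) (subst (λ i → Label x i k') (sym e) (wl k' u'))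
    label-of : Fin n → Fin n
    label-of i = labelAt (x i) i
    label-of-sound : ∀ i → isWitnessᵇ x i ≡ true → Label x i (label-of i)
    label-of-sound i w = let (k , l , _) = isWitness-sound x i w in labelAt-sound x i i (k , l)
    to-label : ∀ i → isWitnessᵇ x i ≡ true → usedᵇ x (label-of i) ≡ true
    to-label i w = usedᵇ-complete x _ (i , label-of-sound i w)
    label-of-injective : ∀ a b → isWitnessᵇ x a ≡ true → isWitnessᵇ x b ≡ true → label-of a ≡ label-of b → a ≡ b
    label-of-injective a b wa wb e =
      witnesses-apart x a b wa wb (label-of a , label-of-sound a wa , subst (Label x b) (sym e) (label-of-sound b wb))

  Atom : Raw → Set
  Atom x = (Σ (Fin n) λ i → Σ (Fin n) λ j → Σ G λ g → (toℕ i < toℕ j) × (x ≈ αpair i j g))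
         ⊎ (Σ (Fin n) λ i → Σ S λ s → x ≈ αzero i s)

  atom⇒rank-one : ∀ x → Atom x → rk x ≡ 1
  atom⇒rank-one x (inj₁ (i , j , g , lt , e)) = trans (rk-≈ x _ e) (rk-αpair i j g lt)
  atom⇒rank-one x (inj₂ (i , s , e))          = trans (rk-≈ x _ e) (rk-αzero i s)

  rank-one⇒one-non-witness : ∀ x → rk x ≡ 1 →
    Σ (Fin n) λ i₀ → (isWitnessᵇ x i₀ ≡ false) × (∀ m → ¬ (m ≡ i₀) → isWitnessᵇ x m ≡ true)
  rank-one⇒one-non-witness x rk≡1 =
    i₀ , Boolₚ.not-injective {y = false} nw , λ m m≢i₀ → Boolₚ.¬-not {y = false} (λ e → m≢i₀ (unique m (cong not e)))
    where
    blocks+1 : numBlocks x + 1 ≡ n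
    blocks+1 = trans (cong (numBlocks x +_) (sym rk≡1)) (m+[n∸m]≡n (numBlocks≤n x))
    non-witnesses : countFin (λ i → not (isWitnessᵇ x i)) ≡ 1
    non-witnesses = +-cancelˡ-≡ (numBlocks x) _ _
      (trans (cong (_+ countFin (λ i → not (isWitnessᵇ x i))) (numBlocks-witnesses x)) (trans (countFin-compl (isWitnessᵇ x)) (sym blocks+1)))
    one = countFin-one _ non-witnesses
    i₀ = proj₁ one
    nw = proj₁ (proj₂ one)
    unique = proj₂ (proj₂ one)

  -- If i₀ is the only non-witness, then either i₀ lies in the zero block
  -- and x is α_{i₀}^s, or i₀ shares a block with exactly one other point j
  -- (the witness of that block) and x is α_{i₀ j}(g) or α_{j i₀}(g).
  rank-one⇒atom : ∀ x → rk x ≡ 1 → Atom x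
  rank-one⇒atom x rk≡1 with i₀ , i₀-not-witness , others ← rank-one⇒one-non-witness x rk≡1 = by-shape (shape (x i₀))
    where
    others-InBlock : ∀ m → ¬ (m ≡ i₀) → InBlock x m
    others-InBlock m m≢i₀ = let (k , l , _) = isWitness-sound x m (others m m≢i₀) in k , l
    others-apart : ∀ a b → ¬ (a ≡ i₀) → ¬ (b ≡ i₀) → SameBlock x a b → a ≡ b
    others-apart a b a≢i₀ b≢i₀ = witnesses-apart x a b (others a a≢i₀) (others b b≢i₀)
    by-shape : Shape (x i₀) → Atom x
    by-shape (zero-entry s x-i₀) = inj₂ (i₀ , s , ≈-αzero x i₀ s x-i₀ others-InBlock singletons)
      where
      singletons : ∀ a b → SameBlock x a b → a ≡ b
      singletons a b sb = others-apart a b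
        (λ { refl → InBlock⇒nonzero x s (SameBlock⇒InBlock x sb) x-i₀ })
        (λ { refl → InBlock⇒nonzero x s (SameBlock⇒InBlock x (SameBlock-sym x sb)) x-i₀ }) sb
    by-shape (block-entry k h x-i₀) = ordered (<-cmp (toℕ j) (toℕ i₀))
      where
      j = witness x k
      i₀~j : SameBlock x i₀ j
      i₀~j = k , (h , x-i₀) , witness-label x k (i₀ , h , x-i₀)
      j≢i₀ : ¬ (j ≡ i₀)
      j≢i₀ eq with () ← trans (sym i₀-not-witness) (isWitness-complete x i₀ x-i₀ eq)
      all-InBlock : ∀ m → InBlock x m
      all-InBlock m with m ≟ i₀
      ... | yes refl  = k , h , x-i₀
      ... | no m≢i₀ = others-InBlock m m≢i₀
      partner : ∀ b → ¬ (b ≡ i₀) → SameBlock x i₀ b → b ≡ j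
      partner b b≢i₀ sb = others-apart b j b≢i₀ j≢i₀ (SameBlock-trans x (SameBlock-sym x sb) i₀~j)
      blocks-of-x : ∀ a b → SameBlock x a b → (a ≡ b) ⊎ (OnPair i₀ j a × OnPair i₀ j b)
      blocks-of-x a b sb with a ≟ i₀ | b ≟ i₀
      ... | yes refl | yes refl = inj₁ refl
      ... | yes refl | no b≢i₀ = inj₂ (inj₁ refl , inj₂ (partner b b≢i₀ sb))
      ... | no a≢i₀ | yes refl = inj₂ (inj₂ (partner a a≢i₀ (SameBlock-sym x sb)) , inj₁ refl)
      ... | no a≢i₀ | no b≢i₀ = inj₁ (others-apart a b a≢i₀ b≢i₀ sb)
      ordered : Tri (toℕ j < toℕ i₀) (toℕ j ≡ toℕ i₀) (toℕ i₀ < toℕ j) → Atom x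
      ordered (tri< lt _ _) = inj₁ (j , i₀ , _ , lt , ≈-αpair x j i₀ lt all-InBlock (SameBlock-sym x i₀~j)
        λ a b sb → map⊎ (λ e → e) (λ (p , q) → swap p , swap q) (blocks-of-x a b sb))
      ordered (tri≈ _ eq _) = ⊥-elim (j≢i₀ (toℕ-injective eq))
      ordered (tri> _ _ gt) = inj₁ (i₀ , j , _ , gt , ≈-αpair x i₀ j gt all-InBlock i₀~j blocks-of-x)

  hasExactly-↔ : ∀ {N} {J : Set} (P : Raw → Set) → Fin N ↔ J → (ψ : J → Raw) → (∀ j → P (ψ j)) →
    (∀ j j' → ψ j ≈ ψ j' → j ≡ j') → (∀ y → P y → Σ J λ j → y ≈ ψ j) → HasExactly P N
  hasExactly-↔ P iso ψ sound injective onto =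
    (λ a → ψ (to a)) , (λ a → sound (to a)) ,
    (λ a b e → trans (sym (strictlyInverseʳ a)) (trans (cong from (injective _ _ e)) (strictlyInverseʳ b))) ,
    λ y Py → let (j , y≈) = onto y Py in from j , subst (λ j' → y ≈ ψ j') (sym (strictlyInverseˡ j)) y≈
    where open Inverse iso

  ∸-step : ∀ m k → suc k ≤ m → m ∸ k ≡ m ∸ suc k + 1
  ∸-step (suc m) zero    _         = +-comm 1 m
  ∸-step (suc m) (suc k) (s≤s k<m) = ∸-step m k k<m

  rank-up : ∀ k ℓ → k < ℓ → ℓ ≤ n → (n ∸ k ≡ n ∸ ℓ + 1) ⇔ (suc k ≡ ℓ)
  rank-up k ℓ k<ℓ ℓ≤n = to , λ { refl → ∸-step n k ℓ≤n }
    where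
    to : n ∸ k ≡ n ∸ ℓ + 1 → suc k ≡ ℓ
    to e = ∸-cancelˡ-≡ (≤-trans k<ℓ ℓ≤n) ℓ≤n
      (+-cancelʳ-≡ 1 _ _ (trans (sym (∸-step n k (≤-trans k<ℓ ℓ≤n))) e))

  covers-count : ∀ x ℓ → ℓ ≤ n → rk x ≡ n ∸ ℓ →
    HasExactly (λ y → (x ⋖ y) × (rk y ≡ n ∸ ℓ + 1)) (ℓ * size + (ℓ C 2) * order)
  covers-count x ℓ ℓ≤n rk≡ with refl ← ∸-cancelˡ-≡ (numBlocks≤n x) ℓ≤n rk≡ =
    hasExactly-↔ _ coverIndex↔ cover (λ j → covers j , rank-of-cover j) cover-injective
      λ y (x⋖y , rk-y) → cover-onto y (proj₁ (proj₁ x⋖y))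
        (proj₁ (rank-up (numBlocks y) ℓ (<ᴰ-numBlocks x y (proj₁ x⋖y)) ℓ≤n) rk-y)
    where
    open Covers x hiding (ℓ)
    rank-of-cover : ∀ j → rk (cover j) ≡ n ∸ ℓ + 1
    rank-of-cover j = proj₂ (rank-up (numBlocks (cover j)) ℓ
      (≤-reflexive (sym (cover-numBlocks j))) ℓ≤n) (sym (cover-numBlocks j))

lemma2p19 : (𝔾 : FinGroup) (𝕊 : FinAction 𝔾) (n : ℕ) → 1 ≤ n →
    let open D 𝔾 𝕊 n in
    (∀ x → (rk x ≡ 1) ⇔
      ((Σ (Fin n) λ i → Σ (Fin n) λ j → Σ G λ g → (toℕ i < toℕ j) × (x ≈ αpair i j g))
       ⊎ (Σ (Fin n) λ i → Σ S λ s → x ≈ αzero i s)))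
    ×
    (∀ x ℓ → ℓ ≤ n → rk x ≡ n ∸ ℓ →
      HasExactly (λ y → (x ⋖ y) × (rk y ≡ n ∸ ℓ + 1))
        (ℓ * FinAction.size 𝕊 + (ℓ C 2) * FinGroup.order 𝔾))
lemma2p19 𝔾 𝕊 n _ = (λ x → rank-one⇒atom x , atom⇒rank-one x) , covers-count
  where open Theory 𝔾 𝕊 n
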